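{- Let $n\ge 1$ and $N=2n+2$. For $w=[w_1,\dots,w_n]\in \widetilde{C}_n/C_n$ write $w_i=c_iN+\sigma_i$ with $c_i\in\mathbb{Z}$ and $\sigma=(\sigma_1,\dots,\sigma_n)\in C_n$, and let $(e_1,\dots,e_n)=\Psi(\sigma)$. Then the map \[ w\longmapsto \lambda=(2c_1-e_1,\,4c_2-e_2,\,\dots,\,2nc_n-e_n) \] is a bijection $\widetilde{C}_n/C_n\to L_n$. Moreover it satisfies $\lambda_i=I_i(w)$ for $1\le i\le n$, and $\lambda_1+\cdots+\lambda_n=\mathsf{inv}_{\widetilde{C}}(w)$.
   Context: $C_n$ denotes the set of signed permutations: sequences $\sigma=(\sigma_1,\dots,\sigma_n)$ of integers such that $(|\sigma_1|,\dots,|\sigma_n|)$ is a permutation of $\{1,\dots,n\}$. $\widetilde{C}_n/C_n$ denotes the set of windows of minimal length coset representatives of the affine hyperoctahedral group modulo the hyperoctahedral group; concretely it is the set of integer tuples $[w_1,\dots,w_n]$ with $0<w_1<w_2<\cdots<w_n$ such that the $2n$ integers $\pm w_1,\dots,\pm w_n$ are pairwise distinct modulo $N=2n+2$. Every such $w$ has a unique representation $w_i=c_iN+\sigma_i$ with $c_i\in\mathbb{Z}$ and $\sigma\in C_n$. For $1\le j\le i\le n$ put $I_{i,j}(w)=\lfloor (w_i-w_j)/N\rfloor+\lfloor (w_i+w_j)/N\rfloor$, $I_i(w)=\sum_{j=1}^{i}I_{i,j}(w)$, and $\mathsf{inv}_{\widetilde{C}}(w)=\sum_{i=1}^n I_i(w)$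 (this equals the Coxeter length). $L_n$ is the set of lecture hall partitions: integer tuples $(\lambda_1,\dots,\lambda_n)$ with $0\le \lambda_1/1\le \lambda_2/2\le\cdots\le\lambda_n/n$. The map $\Psi$ on $C_n$: for $\sigma\in C_n$ let $e^*_i=\#\{j\in\{1,\dots,i-1\}: |\sigma_j|>|\sigma_i|\}$, and set $\Psi(\sigma)=(e_1,\dots,e_n)$ with $e_i=e^*_i$ if $\sigma_i>0$ and $e_i=2i-1-e^*_i$ if $\sigma_i<0$. -}

module Defs where

open import Data.Nat as ℕ using (ℕ; zero; suc)
open import Data.Integer as ℤ using (ℤ; +_; 0ℤ; _+_; _-_; _*_; -_; ∣_∣; _/ℕ_; _%ℕ_)
open import Data.Fin using (Fin; toℕ)
open import Data.Vec using (Vec; lookup; tabulate)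
open import Data.List using (List; filter; length; map; foldr)
open import Data.List using () renaming (allFin to allFinL)
open import Data.Bool using (Bool; true; false; if_then_else_)
open import Data.Product using (_×_; _,_)
open import Relation.Nullary using (¬_; does)
open import Relation.Nullary.Decidable using (_×-dec_)
open import Relation.Binary.PropositionalEquality using (_≡_)
open import Data.Rational.Unnormalised using (ℚᵘ; mkℚᵘ; 0ℚᵘ) renaming (_≤_ to _≤q_)

-- N = 2n+2 (written 2 + 2*n so that it is syntactically a successor)
N : ℕ → ℕ
N n = 2 ℕ.+ 2 ℕ.* n

∑ : ∀ {A : Set} → List A → (A → ℤ) → ℤ
∑ xs f = foldr _+_ 0ℤ (map f xs)

signed : ∀ {n} → Vec ℤ n → Bool × Fin n → ℤ
signed w (true  , i) = lookup w i
signed w (false , i) = - lookup w i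

-- w ∈ C̃_n / C_n :  0 < w_1 < ... < w_n  and  ±w_1,…,±w_n pairwise distinct mod N
IsWindow : (n : ℕ) → Vec ℤ n → Set
IsWindow n w =
  (∀ (i : Fin n) → toℕ i ≡ 0 → 0ℤ ℤ.< lookup w i) ×
  (∀ (i j : Fin n) → toℕ j ≡ suc (toℕ i) → lookup w i ℤ.< lookup w j) ×
  (∀ (p q : Bool × Fin n) → ¬ (p ≡ q) → ¬ (signed w p %ℕ N n ≡ signed w q %ℕ N n))

-- the unique σ_i ∈ {±1,…,±n} with x ≡ σ_i (mod N): signed residue of x
sigma : ℕ → ℤ → ℤ
sigma n x with (x %ℕ N n) ℕ.≤? n
... | Relation.Nullary.yes _ = + (x %ℕ N n)
... | Relation.Nullary.no  _ = + (x %ℕ N n) - + N n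

coef : ℕ → ℤ → ℤ
coef n x = (x - sigma n x) /ℕ N n

σOf : ∀ {n} → Vec ℤ n → Vec ℤ n
σOf {n} w = Data.Vec.map (sigma n) w

cOf : ∀ {n} → Vec ℤ n → Vec ℤ n
cOf {n} w = Data.Vec.map (coef n) w

eStar : ∀ {n} → Vec ℤ n → Fin n → ℕ
eStar {n} σ i =
  length (filter (λ j → (toℕ j ℕ.<? toℕ i) ×-dec (∣ lookup σ i ∣ ℕ.<? ∣ lookup σ j ∣))
                 (allFinL n))

-- Ψ(σ) = (e_1,…,e_n); for the (1-indexed) position i = toℕ i + 1,
-- e_i = e*_i if σ_i > 0, and e_i = 2i - 1 - e*_i if σ_i < 0
Ψ : ∀ {n} → Vec ℤ n → Vec ℤ n
Ψ σ = tabulate λ i →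
  if does (0ℤ ℤ.<? lookup σ i)
    then + eStar σ i
    else + (2 ℕ.* suc (toℕ i)) - + 1 - + eStar σ i

Φ : ∀ {n} → Vec ℤ n → Vec ℤ n
Φ w = tabulate λ i →
  + (2 ℕ.* suc (toℕ i)) * lookup (cOf w) i - lookup (Ψ (σOf w)) i

-- I_{i,j}(w) = ⌊(w_i - w_j)/N⌋ + ⌊(w_i + w_j)/N⌋   (/ℕ is floor division for N > 0)
Iij : ∀ {n} → Vec ℤ n → Fin n → Fin n → ℤ
Iij {n} w i j = (lookup w i - lookup w j) /ℕ N n + (lookup w i + lookup w j) /ℕ N n

Ii : ∀ {n} → Vec ℤ n → Fin n → ℤ
Ii {n} w i = ∑ (filter (λ j → toℕ j ℕ.≤? toℕ i) (allFinL n)) (Iij w i)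

invC : ∀ {n} → Vec ℤ n → ℤ
invC {n} w = ∑ (allFinL n) (Ii w)

sumV : ∀ {n} → Vec ℤ n → ℤ
sumV {n} v = ∑ (allFinL n) (lookup v)

-- lecture hall partitions: 0 ≤ λ_1/1 ≤ λ_2/2 ≤ … ≤ λ_n/n  (λ_i/i as the rational mkℚᵘ λ_i (i-1))
ratio : ∀ {n} → Vec ℤ n → Fin n → ℚᵘ
ratio v i = mkℚᵘ (lookup v i) (toℕ i)

IsLectureHall : (n : ℕ) → Vec ℤ n → Set
IsLectureHall n v =
  (∀ (i : Fin n) → toℕ i ≡ 0 → 0ℚᵘ ≤q ratio v i) ×
  (∀ (i j : Fin n) → toℕ j ≡ suc (toℕ i) → ratio v i ≤q ratio v j)

-- Write w_k = c_k N + σ_k with σ_k the signed residue in [−n−1, n]; the residue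
-- condition on a window says exactly that σ is a signed permutation. Both orders
-- are lexicographic: w_k < w_{k+1} iff c_k < c_{k+1}, or c_k = c_{k+1} and
-- σ_k < σ_{k+1}; and since 0 ≤ e_k ≤ 2k−1, λ_k/k ≤ λ_{k+1}/(k+1) iff c_k < c_{k+1},
-- or c_k = c_{k+1} and k e_{k+1} ≤ (k+1) e_k. A case analysis on the signs and on
-- how e* moves shows that the two tie-breaking conditions agree. The map is
-- bijective because c and e are recovered from λ by division, and σ from Ψ(σ)
-- (its signs and the inversion code of ∣σ∣). Finally
-- ⌊(w_i ± w_j)/N⌋ = c_i ± c_j − [σ_i ± σ_j < 0], so I_i(w) is 2i c_i minus the
-- number of type-B inversions of σ ending at i, which is e_i.
module Submission where

open import Data.Nat
open import Data.Nat.Properties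
open import Data.Nat.Tactic.RingSolver renaming (solve-∀ to ℕ-solve)
open import Data.Integer as ℤ using (ℤ; +_; -[1+_]; 0ℤ; 1ℤ; ∣_∣; _/ℕ_; _%ℕ_; +≤+; -≤-; -≤+; +<+; -<-; -<+)
import Data.Integer.Properties as ℤP
open import Data.Integer.DivMod using (a≡a%ℕn+[a/ℕn]*n; n%ℕd<d)
open import Data.Integer.Tactic.RingSolver renaming (solve-∀ to ℤ-solve)
open import Data.Rational.Unnormalised using (mkℚᵘ; 0ℚᵘ; *≤*) renaming (_≤_ to _≤q_)
open import Data.Bool using (Bool; true; false; if_then_else_; not; _∧_)
open import Data.Product using (_×_; _,_; proj₁; proj₂; ∃)
import Data.Product as Prod
open import Data.Sum using (_⊎_; inj₁; inj₂)
import Data.Sum as Sum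
open import Data.Empty using (⊥-elim)
open import Data.Fin using (Fin; toℕ; fromℕ<) renaming (zero to fzero; suc to fsuc)
open import Data.Fin.Properties using (toℕ<n; toℕ-fromℕ<; toℕ-injective)
open import Data.Vec using (Vec; []; _∷_; lookup; tabulate)
open import Data.Vec.Properties using (lookup-map; lookup∘tabulate)
open import Data.List using (List; filter; length; allFin) renaming ([] to []L; _∷_ to _∷L_; tabulate to tabulateL)
open import Function using (_∘_; id)
open import Function.Bundles using (_⇔_; mk⇔; Equivalence)
import Function.Properties.Equivalence as ⇔
open import Function.Related.Propositional using (module EquationalReasoning; equivalence)
open import Relation.Binary.Definitions using (tri<; tri≈; tri>)
open import Relation.Binary.PropositionalEquality
open import Relation.Nullary using (¬_; Dec; yes; no; does; ¬?)
open import Relation.Nullary.Decidable using (dec-true; dec-false)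

open import Defs

-- Counting

bit : Bool → ℕ
bit true  = 1
bit false = 0

count : (ℕ → Bool) → ℕ → ℕ
count P zero    = 0
count P (suc k) = count P k + bit (P k)

<-suc-cases : ∀ {j k} → j < suc k → j < k ⊎ j ≡ k
<-suc-cases (s≤s j≤k) = m≤n⇒m<n∨m≡n j≤k

does-view : ∀ {A : Set} (d : Dec A) → (A × does d ≡ true) ⊎ (¬ A × does d ≡ false)
does-view (yes a) = inj₁ (a , refl)
does-view (no ¬a) = inj₂ (¬a , refl)

does-true⇒ : ∀ {A : Set} (d : Dec A) → does d ≡ true → A
does-true⇒ (yes a) _ = a

does-cong : ∀ {A B : Set} → (A → B) → (B → A) → (d : Dec A) (e : Dec B) → does d ≡ does e
does-cong f g (yes a)  e = sym (dec-true e (f a))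
does-cong f g (no ¬a) e = sym (dec-false e (¬a ∘ g))

bit-mono : ∀ {a b} → (a ≡ true → b ≡ true) → bit a ≤ bit b
bit-mono {false} _ = z≤n
bit-mono {true}  h rewrite h refl = ≤-refl

count-cong : ∀ {P Q} k → (∀ j → j < k → P j ≡ Q j) → count P k ≡ count Q k
count-cong zero    h = refl
count-cong (suc k) h = cong₂ _+_ (count-cong k (λ j p → h j (m<n⇒m<1+n p))) (cong bit (h k ≤-refl))

count-mono : ∀ {P Q} k → (∀ j → j < k → P j ≡ true → Q j ≡ true) → count P k ≤ count Q k
count-mono zero    h = z≤n
count-mono (suc k) h = +-mono-≤ (count-mono k (λ j p → h j (m<n⇒m<1+n p))) (bit-mono (h k ≤-refl))

count-< : ∀ {P Q} k → (∀ j → j < k → P j ≡ true → Q j ≡ true) →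
  ∀ j → j < k → P j ≡ false → Q j ≡ true → count P k < count Q k
count-< (suc k) h j j<k pj qj with <-suc-cases j<k
... | inj₁ j<k′ = +-mono-<-≤ (count-< k (λ i p → h i (m<n⇒m<1+n p)) j j<k′ pj qj) (bit-mono (h k ≤-refl))
... | inj₂ refl rewrite pj | qj = +-mono-≤-< (count-mono j (λ i p → h i (m<n⇒m<1+n p))) (s≤s z≤n)

count-≤-+ : ∀ {R P Q} k → (∀ j → j < k → bit (R j) ≤ bit (P j) + bit (Q j)) →
  count R k ≤ count P k + count Q k
count-≤-+ zero h = z≤n
count-≤-+ {R} {P} {Q} (suc k) h = begin
  count R k + bit (R k)                            ≤⟨ +-mono-≤ (count-≤-+ k (λ j p → h j (m<n⇒m<1+n p))) (h k ≤-refl) ⟩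
  (count P k + count Q k) + (bit (P k) + bit (Q k)) ≡⟨ interchange (count P k) (count Q k) (bit (P k)) (bit (Q k)) ⟩
  (count P k + bit (P k)) + (count Q k + bit (Q k)) ∎
  where
  open ≤-Reasoning
  interchange : ∀ a b c d → (a + b) + (c + d) ≡ (a + c) + (b + d)
  interchange = ℕ-solve

count-+-count-not : ∀ P k → count P k + count (not ∘ P) k ≡ k
count-+-count-not P zero = refl
count-+-count-not P (suc k) = begin
  (count P k + bit (P k)) + (count (not ∘ P) k + bit (not (P k))) ≡⟨ interchange (count P k) (bit (P k)) _ _ ⟩
  (count P k + count (not ∘ P) k) + (bit (P k) + bit (not (P k))) ≡⟨ cong₂ _+_ (count-+-count-not P k) (bit+bit-not (P k)) ⟩
  k + 1                                                            ≡⟨ +-comm k 1 ⟩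
  suc k ∎
  where
  open ≡-Reasoning
  interchange : ∀ a b c d → (a + b) + (c + d) ≡ (a + c) + (b + d)
  interchange = ℕ-solve
  bit+bit-not : ∀ b → bit b + bit (not b) ≡ 1
  bit+bit-not true  = refl
  bit+bit-not false = refl

count-none : ∀ {P} k → (∀ j → j < k → P j ≡ false) → count P k ≡ 0
count-none zero    h = refl
count-none (suc k) h rewrite h k ≤-refl | count-none k (λ j p → h j (m<n⇒m<1+n p)) = refl

count≤ : ∀ P k → count P k ≤ k
count≤ P k = subst (count P k ≤_) (count-+-count-not P k) (m≤m+n _ _)

InjectiveBelow : ℕ → (ℕ → ℕ) → Set
InjectiveBelow k p = ∀ i j → i < k → j < k → p i ≡ p j → i ≡ j

ValuesIn : ℕ → (ℕ → ℕ) → Set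
ValuesIn k p = ∀ j → j < k → 1 ≤ p j × p j ≤ k

IsPermutation : ℕ → (ℕ → ℕ) → Set
IsPermutation k p = InjectiveBelow k p × ValuesIn k p

injectiveBelow-pred : ∀ {p k} → InjectiveBelow (suc k) p → InjectiveBelow k p
injectiveBelow-pred inj i j i<k j<k = inj i j (m<n⇒m<1+n i<k) (m<n⇒m<1+n j<k)

count-≡≤1 : ∀ p h k → InjectiveBelow k p → count (λ j → does (p j ≟ h)) k ≤ 1
count-≡≤1 p h zero    inj = z≤n
count-≡≤1 p h (suc k) inj with p k ≟ h
... | no p≢h rewrite dec-false (p k ≟ h) p≢h | +-identityʳ (count (λ j → does (p j ≟ h)) k) =
  count-≡≤1 p h k (injectiveBelow-pred inj)
... | yes e = ≤-reflexive (cong₂ _+_ earlier-none (cong bit (dec-true (p k ≟ h) e)))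
  where
  earlier-none : count (λ j → does (p j ≟ h)) k ≡ 0
  earlier-none = count-none k (λ j j<k → dec-false (p j ≟ h)
    (λ e′ → <⇒≢ j<k (inj j k (m<n⇒m<1+n j<k) ≤-refl (trans e′ (sym e)))))

between : ℕ → ℕ → ℕ → Bool
between lo hi x = does (lo ≤? x) ∧ does (x <? hi)

between-suc : ∀ lo h x → bit (between lo (suc h) x) ≤ bit (between lo h x) + bit (does (x ≟ h))
between-suc lo h x with does-view (lo ≤? x)
... | inj₂ (_ , e) rewrite e = z≤n
... | inj₁ (_ , e) rewrite e with does-view (x <? suc h) | does-view (x <? h) | does-view (x ≟ h)
... | inj₂ (_ , e₁) | _             | _             rewrite e₁           = z≤n
... | inj₁ (_ , e₁) | inj₁ (_ , e₂) | _             rewrite e₁ | e₂      = s≤s z≤n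
... | inj₁ (_ , e₁) | inj₂ (_ , e₂) | inj₁ (_ , e₃) rewrite e₁ | e₂ | e₃ = s≤s z≤n
... | inj₁ (x<1+h , _) | inj₂ (x≮h , _) | inj₂ (x≢h , _) = ⊥-elim (x≢h (≤-antisym (≤-pred x<1+h) (≮⇒≥ x≮h)))

between-empty : ∀ lo hi x → hi ≤ lo → between lo hi x ≡ false
between-empty lo hi x hi≤lo with does-view (lo ≤? x)
... | inj₂ (_ , e) rewrite e = refl
... | inj₁ (lo≤x , e) rewrite e = dec-false (x <? hi) (λ x<hi → <⇒≱ (≤-<-trans lo≤x x<hi) hi≤lo)

count-between≤ : ∀ p k lo hi → InjectiveBelow k p → count (λ j → between lo hi (p j)) k ≤ hi ∸ lo
count-between≤ p k lo zero inj =
  subst (_≤ 0 ∸ lo) (sym (count-none k (λ j _ → between-empty lo 0 (p j) z≤n))) z≤n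
count-between≤ p k lo (suc h) inj with lo ≤? h
... | no lo≰h = subst (_≤ suc h ∸ lo) (sym (count-none k (λ j _ → between-empty lo (suc h) (p j) (≰⇒> lo≰h)))) z≤n
... | yes lo≤h = begin
  count (λ j → between lo (suc h) (p j)) k                            ≤⟨ count-≤-+ k (λ j _ → between-suc lo h (p j)) ⟩
  count (λ j → between lo h (p j)) k + count (λ j → does (p j ≟ h)) k ≤⟨ +-mono-≤ (count-between≤ p k lo h inj) (count-≡≤1 p h k inj) ⟩
  (h ∸ lo) + 1                                                       ≡⟨ +-comm (h ∸ lo) 1 ⟩
  suc (h ∸ lo)                                                       ≡⟨ sym (+-∸-assoc 1 lo≤h) ⟩
  suc h ∸ lo ∎
  where open ≤-Reasoning

-- Pigeonhole from both sides: at most x ∸ 1 values lie in [1, x) and at most k ∸ (x ∸ 1) in [x, k].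
count-<-permutation : ∀ p k x → IsPermutation k p → 1 ≤ x → x ≤ suc k →
  count (λ j → does (p j <? x)) k ≡ x ∸ 1
count-<-permutation p k (suc x) (inj , into) (s≤s z≤n) x≤ = ≤-antisym below≤ below≥
  where
  below = count (λ j → does (p j <? suc x)) k
  above = count (λ j → not (does (p j <? suc x))) k
  below≤ : below ≤ x
  below≤ = ≤-trans (count-mono k in-range) (count-between≤ p k 1 (suc x) inj)
    where
    in-range : ∀ j → j < k → does (p j <? suc x) ≡ true → between 1 (suc x) (p j) ≡ true
    in-range j j<k e rewrite dec-true (1 ≤? p j) (proj₁ (into j j<k)) = e
  above≤ : above ≤ k ∸ x
  above≤ = ≤-trans (count-mono k in-range) (count-between≤ p k (suc x) (suc k) inj)
    where
    in-range : ∀ j → j < k → not (does (p j <? suc x)) ≡ true → between (suc x) (suc k) (p j) ≡ true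
    in-range j j<k e with does-view (p j <? suc x)
    ... | inj₁ (_ , e′) rewrite e′ with () ← e
    ... | inj₂ (p≮ , _) rewrite dec-true (suc x ≤? p j) (≮⇒≥ p≮) =
      dec-true (p j <? suc k) (s≤s (proj₂ (into j j<k)))
  below≥ : x ≤ below
  below≥ = +-cancelʳ-≤ (k ∸ x) x below (begin
    x + (k ∸ x)    ≡⟨ m+[n∸m]≡n (≤-pred x≤) ⟩
    k              ≡⟨ sym (count-+-count-not (λ j → does (p j <? suc x)) k) ⟩
    below + above  ≤⟨ +-monoʳ-≤ below above≤ ⟩
    below + (k ∸ x) ∎)
    where open ≤-Reasoning

-- Inversion codes

code : (ℕ → ℕ) → ℕ → ℕ
code a i = count (λ j → does (a i <? a j)) i

code≤ : ∀ a k → code a k ≤ k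
code≤ a k = count≤ _ k

code-suc-≤ : ∀ a k → a k < a (suc k) → code a (suc k) ≤ code a k
code-suc-≤ a k a<a′ rewrite dec-false (a (suc k) <? a k) (<-asym a<a′) | +-identityʳ (count (λ j → does (a (suc k) <? a j)) k) =
  count-mono k (λ j _ e → dec-true (a k <? a j) (<-trans a<a′ (does-true⇒ (a (suc k) <? a j) e)))

code-suc-> : ∀ a k → a (suc k) < a k → suc (code a k) ≤ code a (suc k)
code-suc-> a k a′<a rewrite dec-true (a (suc k) <? a k) a′<a | +-comm (count (λ j → does (a (suc k) <? a j)) k) 1 =
  s≤s (count-mono k (λ j _ e → dec-true (a (suc k) <? a j) (<-trans a′<a (does-true⇒ (a k <? a j) e))))

bump : ℕ → ℕ → ℕ
bump r x = if does (r ≤? x) then suc x else x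

bump-view : ∀ r x → (r ≤ x × bump r x ≡ suc x) ⊎ (x < r × bump r x ≡ x)
bump-view r x with does-view (r ≤? x)
... | inj₁ (r≤x , e) rewrite e = inj₁ (r≤x , refl)
... | inj₂ (r≰x , e) rewrite e = inj₂ (≰⇒> r≰x , refl)

bump-mono-< : ∀ r {x y} → x < y → bump r x < bump r y
bump-mono-< r {x} {y} x<y with bump-view r x | bump-view r y
... | inj₁ (_ , e₁)   | inj₁ (_ , e₂)   rewrite e₁ | e₂ = s≤s x<y
... | inj₁ (r≤x , _)  | inj₂ (y<r , _)  = ⊥-elim (<⇒≱ (<-trans x<y y<r) r≤x)
... | inj₂ (_ , e₁)   | inj₁ (_ , e₂)   rewrite e₁ | e₂ = m<n⇒m<1+n x<y
... | inj₂ (_ , e₁)   | inj₂ (_ , e₂)   rewrite e₁ | e₂ = x<y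

bump-cancel-< : ∀ r {x y} → bump r x < bump r y → x < y
bump-cancel-< r {x} {y} b with <-cmp x y
... | tri< x<y _ _ = x<y
... | tri≈ _ refl _ = ⊥-elim (<-irrefl refl b)
... | tri> _ _ y<x = ⊥-elim (<-asym b (bump-mono-< r y<x))

bump-injective : ∀ r {x y} → bump r x ≡ bump r y → x ≡ y
bump-injective r {x} {y} e with <-cmp x y
... | tri< x<y _ _ = ⊥-elim (<⇒≢ (bump-mono-< r x<y) e)
... | tri≈ _ x≡y _ = x≡y
... | tri> _ _ y<x = ⊥-elim (<⇒≢ (bump-mono-< r y<x) (sym e))

bump≢ : ∀ r x → bump r x ≢ r
bump≢ r x e with bump-view r x
... | inj₁ (r≤x , e₁) = <⇒≢ (s≤s r≤x) (trans (sym e) e₁)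
... | inj₂ (x<r , e₁) = <⇒≢ x<r (trans (sym e₁) e)

<-bump⇔≮ : ∀ r x → r < bump r x ⇔ (¬ x < r)
<-bump⇔≮ r x with bump-view r x
... | inj₁ (r≤x , e) rewrite e = mk⇔ (λ _ → ≤⇒≯ r≤x) (λ _ → s≤s r≤x)
... | inj₂ (x<r , e) rewrite e = mk⇔ (λ r<x → ⊥-elim (<-asym x<r r<x)) (λ x≮r → ⊥-elim (x≮r x<r))

-- decode d k lists a permutation of 1…k whose inversion code is d (given d i ≤ i):
-- the k-th entry gets rank suc k ∸ d k among the first suc k values.
decode : (ℕ → ℕ) → ℕ → ℕ → ℕ
decode d zero    j = 0
decode d (suc k) j = if does (j <? k) then bump (suc k ∸ d k) (decode d k j) else suc k ∸ d k

decode-< : ∀ d k j → j < k → decode d (suc k) j ≡ bump (suc k ∸ d k) (decode d k j)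
decode-< d k j j<k rewrite dec-true (j <? k) j<k = refl

decode-last : ∀ d k → decode d (suc k) k ≡ suc k ∸ d k
decode-last d k rewrite dec-false (k <? k) (<-irrefl refl) = refl

module Decode (d : ℕ → ℕ) (d≤ : ∀ i → d i ≤ i) where

  1≤rank : ∀ k → 1 ≤ suc k ∸ d k
  1≤rank k = subst (1 ≤_) (sym (+-∸-assoc 1 (d≤ k))) (s≤s z≤n)

  decode-values : ∀ k → ValuesIn k (decode d k)
  decode-values (suc k) j j<1+k with <-suc-cases j<1+k
  ... | inj₂ refl rewrite decode-last d j = 1≤rank j , m∸n≤m (suc j) (d j)
  ... | inj₁ j<k rewrite decode-< d k j j<k with decode-values k j j<k
  ...   | (1≤ , ≤k) with bump-view (suc k ∸ d k) (decode d k j)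
  ...     | inj₁ (_ , e) rewrite e = s≤s z≤n , s≤s ≤k
  ...     | inj₂ (_ , e) rewrite e = 1≤ , m≤n⇒m≤1+n ≤k

  decode-injective : ∀ k → InjectiveBelow k (decode d k)
  decode-injective (suc k) i j i< j< e with <-suc-cases i< | <-suc-cases j<
  ... | inj₂ refl | inj₂ refl = refl
  ... | inj₁ i<k  | inj₁ j<k  = decode-injective k i j i<k j<k
    (bump-injective (suc k ∸ d k) (trans (sym (decode-< d k i i<k)) (trans e (decode-< d k j j<k))))
  ... | inj₁ i<k  | inj₂ refl = ⊥-elim (bump≢ (suc k ∸ d k) (decode d k i)
    (trans (sym (decode-< d k i i<k)) (trans e (decode-last d j))))
  ... | inj₂ refl | inj₁ j<k  = ⊥-elim (bump≢ (suc k ∸ d k) (decode d k j)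
    (trans (sym (decode-< d k j j<k)) (trans (sym e) (decode-last d i))))

  decode-permutation : ∀ k → IsPermutation k (decode d k)
  decode-permutation k = decode-injective k , decode-values k

  code-decode : ∀ k i → i < k → code (decode d k) i ≡ d i
  code-decode (suc k) i i<1+k with <-suc-cases i<1+k
  ... | inj₁ i<k = trans (count-cong i (λ j j<i → does-cong
          (λ lt → bump-cancel-< r′ (subst₂ _<_ (decode-< d k i i<k) (decode-< d k j (<-trans j<i i<k)) lt))
          (λ lt → subst₂ _<_ (sym (decode-< d k i i<k)) (sym (decode-< d k j (<-trans j<i i<k))) (bump-mono-< r′ lt))
          (decode d (suc k) i <? decode d (suc k) j) (decode d k i <? decode d k j)))
        (code-decode k i i<k)
    where r′ = suc k ∸ d k
  ... | inj₂ refl = begin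
    count (λ j → does (decode d (suc i) i <? decode d (suc i) j)) i
      ≡⟨ count-cong i (λ j j<i → does-cong
           (λ lt → Equivalence.to (<-bump⇔≮ r (p j)) (subst₂ _<_ (decode-last d i) (decode-< d i j j<i) lt))
           (λ lt → subst₂ _<_ (sym (decode-last d i)) (sym (decode-< d i j j<i)) (Equivalence.from (<-bump⇔≮ r (p j)) lt))
           (decode d (suc i) i <? decode d (suc i) j) (¬? (p j <? r))) ⟩
    count (not ∘ below) i
      ≡⟨ sym (m+n∸m≡n (count below i) _) ⟩
    (count below i + count (not ∘ below) i) ∸ count below i
      ≡⟨ cong₂ _∸_ (count-+-count-not below i)
                   (count-<-permutation p i r (decode-permutation i) (1≤rank i) (m∸n≤m (suc i) (d i))) ⟩
    i ∸ (r ∸ 1)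
      ≡⟨ cong (λ t → i ∸ (t ∸ 1)) (+-∸-assoc 1 (d≤ i)) ⟩
    i ∸ (i ∸ d i)
      ≡⟨ m∸[m∸n]≡n (d≤ i) ⟩
    d i ∎
    where
    open ≡-Reasoning
    r = suc i ∸ d i
    p = decode d i
    below = λ j → does (p j <? r)

SameOrder : (ℕ → ℕ) → (ℕ → ℕ) → ℕ → Set
SameOrder x y m = ∀ j j′ → j < m → j′ < m → x j < x j′ → y j < y j′

injective⇒< : ∀ {y n j m} → InjectiveBelow n y → j < n → m < n → j ≢ m → ¬ (y m < y j) → y j < y m
injective⇒< {y} {n} {j} {m} inj j<n m<n j≢m ≮ = ≤∧≢⇒< (≮⇒≥ ≮) (λ e → j≢m (inj j m j<n m<n e))

-- If x and y order the first m entries alike and have the same code at m,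
-- then x m cannot lie strictly below an earlier entry unless y m does too:
-- otherwise y m would count strictly fewer larger predecessors.
same-code-preserves-> : ∀ x y n m → InjectiveBelow n y → m < n → SameOrder y x m → code x m ≡ code y m →
  ∀ j → j < m → x m < x j → y m < y j
same-code-preserves-> x y n m inj m<n y≺x same j j<m xm<xj with y m <? y j
... | yes lt = lt
... | no ≮ = ⊥-elim (<-irrefl (sym same) fewer)
  where
  yj<ym : y j < y m
  yj<ym = injective⇒< inj (<-trans j<m m<n) m<n (<⇒≢ j<m) ≮
  fewer : code y m < code x m
  fewer = count-< m (λ k k<m e → dec-true (x m <? x k)
            (<-trans xm<xj (y≺x j k j<m k<m (<-trans yj<ym (does-true⇒ (y m <? y k) e)))))
          j j<m (dec-false (y m <? y j) ≮) (dec-true (x m <? x j) xm<xj)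

same-order-suc : ∀ x y n m → InjectiveBelow n x → InjectiveBelow n y → m < n →
  code x m ≡ code y m → SameOrder x y m → SameOrder y x m → SameOrder x y (suc m)
same-order-suc x y n m inj-x inj-y m<n same x≺y y≺x j j′ j< j′< lt with <-suc-cases j< | <-suc-cases j′<
... | inj₁ j<m  | inj₁ j′<m = x≺y j j′ j<m j′<m lt
... | inj₂ refl | inj₂ refl = ⊥-elim (<-irrefl refl lt)
... | inj₂ refl | inj₁ j′<m = same-code-preserves-> x y n j inj-y m<n y≺x same j′ j′<m lt
... | inj₁ j<m  | inj₂ refl with y j <? y j′
...   | yes lt′ = lt′
...   | no ≮ = ⊥-elim (<-asym lt (same-code-preserves-> y x n j′ inj-x m<n x≺y (sym same) j j<m
                   (injective⇒< inj-y m<n (<-trans j<m m<n) (λ e → <⇒≢ j<m (sym e)) ≮)))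

code-injective : ∀ a b n → IsPermutation n a → IsPermutation n b →
  (∀ i → i < n → code a i ≡ code b i) → ∀ i → i < n → a i ≡ b i
code-injective a b n perm-a@(inj-a , into-a) perm-b@(inj-b , into-b) same i i<n = begin
  a i                                        ≡⟨ sym (suc-pred (a i) {{>-nonZero (proj₁ (into-a i i<n))}}) ⟩
  suc (a i ∸ 1)                              ≡⟨ cong suc (sym (rank a perm-a)) ⟩
  suc (count (λ j → does (a j <? a i)) n)   ≡⟨ cong suc (count-cong n (λ j j<n → does-cong
                                                  (proj₁ (orders n ≤-refl) j i j<n i<n) (proj₂ (orders n ≤-refl) j i j<n i<n)
                                                  (a j <? a i) (b j <? b i))) ⟩
  suc (count (λ j → does (b j <? b i)) n)   ≡⟨ cong suc (rank b perm-b) ⟩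
  suc (b i ∸ 1)                              ≡⟨ suc-pred (b i) {{>-nonZero (proj₁ (into-b i i<n))}} ⟩
  b i ∎
  where
  open ≡-Reasoning
  rank : ∀ p → IsPermutation n p → count (λ j → does (p j <? p i)) n ≡ p i ∸ 1
  rank p perm@(_ , into) = count-<-permutation p n (p i) perm (proj₁ (into i i<n)) (m≤n⇒m≤1+n (proj₂ (into i i<n)))
  orders : ∀ m → m ≤ n → SameOrder a b m × SameOrder b a m
  orders zero    _   = (λ _ _ ()) , (λ _ _ ())
  orders (suc m) m<n with orders m (<⇒≤ m<n)
  ... | (a≺b , b≺a) = same-order-suc a b n m inj-a inj-b m<n (same m m<n) a≺b b≺a
                    , same-order-suc b a n m inj-b inj-a m<n (sym (same m m<n)) b≺a a≺b

-- Integer arithmetic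

neg-+-cancel : ∀ a b → ℤ.- a ℤ.+ (a ℤ.+ b) ≡ b
neg-+-cancel = ℤ-solve

ℤ-+-cancelˡ-≡ : ∀ a {b c} → a ℤ.+ b ≡ a ℤ.+ c → b ≡ c
ℤ-+-cancelˡ-≡ a {b} {c} e = trans (sym (neg-+-cancel a b)) (trans (cong (λ t → ℤ.- a ℤ.+ t) e) (neg-+-cancel a c))

ℤ-+-cancelˡ-≤ : ∀ a {b c} → a ℤ.+ b ℤ.≤ a ℤ.+ c → b ℤ.≤ c
ℤ-+-cancelˡ-≤ a {b} {c} le = subst₂ ℤ._≤_ (neg-+-cancel a b) (neg-+-cancel a c) (ℤP.+-monoʳ-≤ (ℤ.- a) le)

ℤ-+-cancelˡ-< : ∀ a {b c} → a ℤ.+ b ℤ.< a ℤ.+ c → b ℤ.< c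
ℤ-+-cancelˡ-< a {b} {c} lt = subst₂ ℤ._<_ (neg-+-cancel a b) (neg-+-cancel a c) (ℤP.+-monoʳ-< (ℤ.- a) lt)

0≤+ : ∀ m → 0ℤ ℤ.≤ + m
0≤+ m = +≤+ z≤n

+∸+ : ∀ a b → b ≤ a → + a ℤ.- + b ≡ + (a ∸ b)
+∸+ a b b≤a = begin
  + a ℤ.- + b               ≡⟨ cong (λ t → + t ℤ.- + b) (sym (m∸n+n≡m b≤a)) ⟩
  + (a ∸ b + b) ℤ.- + b     ≡⟨ cong (ℤ._- + b) (ℤP.pos-+ (a ∸ b) b) ⟩
  + (a ∸ b) ℤ.+ + b ℤ.- + b ≡⟨ add-sub (+ (a ∸ b)) (+ b) ⟩
  + (a ∸ b) ∎
  where
  open ≡-Reasoning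
  add-sub : ∀ x y → x ℤ.+ y ℤ.- y ≡ x
  add-sub = ℤ-solve

Small : ℕ → ℤ → Set
Small M r = ℤ.- + M ℤ.< r × r ℤ.< + M

small-neg : ∀ {M r} → Small M r → Small M (ℤ.- r)
small-neg {M} (-M<r , r<M) = ℤP.neg-mono-< r<M , subst (ℤ.- _ ℤ.<_) (ℤP.neg-involutive (+ M)) (ℤP.neg-mono-< -M<r)

small-window : ∀ M {lo s s′} → lo ℤ.≤ s → s ℤ.< lo ℤ.+ + M → lo ℤ.≤ s′ → s′ ℤ.< lo ℤ.+ + M → Small M (s′ ℤ.- s)
small-window M {lo} {s} {s′} lo≤s s<top lo≤s′ s′<top =
  subst₂ ℤ._<_ (lower lo (+ M)) refl (ℤP.+-mono-≤-< lo≤s′ (ℤP.neg-mono-< s<top)) ,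
  subst₂ ℤ._<_ refl (upper lo (+ M)) (ℤP.+-mono-<-≤ s′<top (ℤP.neg-mono-≤ lo≤s))
  where
  lower : ∀ l m → l ℤ.+ ℤ.- (l ℤ.+ m) ≡ ℤ.- m
  lower = ℤ-solve
  upper : ∀ l m → l ℤ.+ m ℤ.+ ℤ.- l ≡ m
  upper = ℤ-solve

small-∸ : ∀ {M a b} → a < M → b < M → Small M (+ a ℤ.- + b)
small-∸ {M} {a} {b} a<M b<M = small-window M (0≤+ b) (+<+ b<M) (0≤+ a) (+<+ a<M)

i<j⇒0<j-i : ∀ {i j} → i ℤ.< j → 0ℤ ℤ.< j ℤ.- i
i<j⇒0<j-i {i} {j} i<j = subst (ℤ._< j ℤ.- i) (ℤP.+-inverseʳ i) (ℤP.+-monoˡ-< (ℤ.- i) i<j)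

reversed : ∀ {M s s′} → Small M (s′ ℤ.- s) → ℤ.- + M ℤ.< s ℤ.- s′
reversed {M} {s} {s′} small = subst (ℤ.- + M ℤ.<_) (negate-diff s′ s) (proj₁ (small-neg small))
  where
  negate-diff : ∀ a b → ℤ.- (a ℤ.- b) ≡ b ℤ.- a
  negate-diff = ℤ-solve

dominant-pos : ∀ M {x r} → 0ℤ ℤ.< x → ℤ.- + M ℤ.< r → 0ℤ ℤ.< x ℤ.* + M ℤ.+ r
dominant-pos M {x} {r} 0<x -M<r = begin-strict
  0ℤ                ≡⟨ sym (ℤP.+-inverseʳ (+ M)) ⟩
  + M ℤ.+ ℤ.- + M   <⟨ ℤP.+-monoʳ-< (+ M) -M<r ⟩
  + M ℤ.+ r         ≤⟨ ℤP.+-monoˡ-≤ r M≤xM ⟩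
  x ℤ.* + M ℤ.+ r   ∎
  where
  open ℤP.≤-Reasoning
  M≤xM : + M ℤ.≤ x ℤ.* + M
  M≤xM = subst (ℤ._≤ x ℤ.* + M) (ℤP.*-identityˡ (+ M)) (ℤP.*-monoʳ-≤-nonNeg (+ M) (ℤP.i<j⇒suc[i]≤j 0<x))

lex-< : ∀ M {a a′ s s′} → ℤ.- + M ℤ.< s′ ℤ.- s → a ℤ.< a′ → a ℤ.* + M ℤ.+ s ℤ.< a′ ℤ.* + M ℤ.+ s′
lex-< M {a} {a′} {s} {s′} -M<δ a<a′ = subst₂ ℤ._<_ (ℤP.+-identityʳ _) (split a a′ s s′ (+ M))
  (ℤP.+-monoʳ-< (a ℤ.* + M ℤ.+ s) (dominant-pos M (i<j⇒0<j-i a<a′) -M<δ))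
  where
  split : ∀ a a′ s s′ m → a ℤ.* m ℤ.+ s ℤ.+ ((a′ ℤ.- a) ℤ.* m ℤ.+ (s′ ℤ.- s)) ≡ a′ ℤ.* m ℤ.+ s′
  split = ℤ-solve

lex-<-iff : ∀ M {a a′ s s′} → Small M (s′ ℤ.- s) →
  a ℤ.* + M ℤ.+ s ℤ.< a′ ℤ.* + M ℤ.+ s′ ⇔ (a ℤ.< a′ ⊎ (a ≡ a′ × s ℤ.< s′))
lex-<-iff M {a} {a′} {s} {s′} small@(-M<δ , _) = mk⇔ to from
  where
  to : a ℤ.* + M ℤ.+ s ℤ.< a′ ℤ.* + M ℤ.+ s′ → a ℤ.< a′ ⊎ (a ≡ a′ × s ℤ.< s′)
  to lt with ℤP.<-cmp a a′
  ... | tri< a<a′ _ _ = inj₁ a<a′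
  ... | tri≈ _ refl _ = inj₂ (refl , ℤ-+-cancelˡ-< (a ℤ.* + M) lt)
  ... | tri> _ _ a′<a = ⊥-elim (ℤP.<-asym lt (lex-< M (reversed {M} {s} {s′} small) a′<a))
  from : a ℤ.< a′ ⊎ (a ≡ a′ × s ℤ.< s′) → a ℤ.* + M ℤ.+ s ℤ.< a′ ℤ.* + M ℤ.+ s′
  from (inj₁ a<a′)         = lex-< M -M<δ a<a′
  from (inj₂ (refl , s<s′)) = ℤP.+-monoʳ-< (a ℤ.* + M) s<s′

lex-≤-iff : ∀ M {a a′ s s′} → Small M (s′ ℤ.- s) →
  a ℤ.* + M ℤ.+ s ℤ.≤ a′ ℤ.* + M ℤ.+ s′ ⇔ (a ℤ.< a′ ⊎ (a ≡ a′ × s ℤ.≤ s′))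
lex-≤-iff M {a} {a′} {s} {s′} small@(-M<δ , _) = mk⇔ to from
  where
  to : a ℤ.* + M ℤ.+ s ℤ.≤ a′ ℤ.* + M ℤ.+ s′ → a ℤ.< a′ ⊎ (a ≡ a′ × s ℤ.≤ s′)
  to le with ℤP.<-cmp a a′
  ... | tri< a<a′ _ _ = inj₁ a<a′
  ... | tri≈ _ refl _ = inj₂ (refl , ℤ-+-cancelˡ-≤ (a ℤ.* + M) le)
  ... | tri> _ _ a′<a = ⊥-elim (ℤP.≤⇒≯ le (lex-< M (reversed {M} {s} {s′} small) a′<a))
  from : a ℤ.< a′ ⊎ (a ≡ a′ × s ℤ.≤ s′) → a ℤ.* + M ℤ.+ s ℤ.≤ a′ ℤ.* + M ℤ.+ s′
  from (inj₁ a<a′)         = ℤP.<⇒≤ (lex-< M -M<δ a<a′)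
  from (inj₂ (refl , s≤s′)) = ℤP.+-monoʳ-≤ (a ℤ.* + M) s≤s′

lex-unique : ∀ M {a a′ s s′} → Small M (s′ ℤ.- s) →
  a ℤ.* + M ℤ.+ s ≡ a′ ℤ.* + M ℤ.+ s′ → a ≡ a′ × s ≡ s′
lex-unique M {a} {a′} {s} {s′} small e with Equivalence.to (lex-≤-iff M {a} {a′} {s} {s′} small) (ℤP.≤-reflexive e)
... | inj₁ a<a′ = ⊥-elim (ℤP.<-irrefl e (lex-< M (proj₁ small) a<a′))
... | inj₂ (refl , _) = refl , ℤ-+-cancelˡ-≡ (a ℤ.* + M) e

div-mod-unique : ∀ d .{{_ : NonZero d}} {x} q r → r < d → x ≡ q ℤ.* + d ℤ.+ + r → x /ℕ d ≡ q × x %ℕ d ≡ r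
div-mod-unique d {x} q r r<d e
  with lex-unique d {q} {x /ℕ d} {+ r} {+ (x %ℕ d)} (small-∸ (n%ℕd<d x d) r<d)
         (trans (sym e) (trans (a≡a%ℕn+[a/ℕn]*n x d) (ℤP.+-comm (+ (x %ℕ d)) (x /ℕ d ℤ.* + d))))
... | q≡ , r≡ = sym q≡ , sym (ℤP.+-injective r≡)

%ℕ-shift : ∀ d .{{_ : NonZero d}} {x y} k → x ≡ y ℤ.+ k ℤ.* + d → x %ℕ d ≡ y %ℕ d
%ℕ-shift d {x} {y} k e = proj₂ (div-mod-unique d {x} (y /ℕ d ℤ.+ k) (y %ℕ d) (n%ℕd<d y d)
  (trans e (trans (cong (ℤ._+ k ℤ.* + d) (a≡a%ℕn+[a/ℕn]*n y d)) (regroup (+ (y %ℕ d)) (y /ℕ d) k (+ d)))))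
  where
  regroup : ∀ r q k d → r ℤ.+ q ℤ.* d ℤ.+ k ℤ.* d ≡ (q ℤ.+ k) ℤ.* d ℤ.+ r
  regroup = ℤ-solve

floor-/ℕ : ∀ d .{{_ : NonZero d}} {x} c t → x ≡ c ℤ.* + d ℤ.+ t → ℤ.- + d ℤ.≤ t → t ℤ.< + d →
  x /ℕ d ≡ c ℤ.- + bit (does (t ℤ.<? 0ℤ))
floor-/ℕ d {x} c (+ m) e _ (+<+ m<d) = begin
  x /ℕ d       ≡⟨ proj₁ (div-mod-unique d c m m<d e) ⟩
  c            ≡⟨ sym (ℤP.+-identityʳ c) ⟩
  c ℤ.- + 0    ≡⟨ cong (λ b → c ℤ.- + bit b) (sym (dec-false (+ m ℤ.<? 0ℤ) (ℤP.≤⇒≯ (0≤+ m)))) ⟩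
  c ℤ.- + bit (does (+ m ℤ.<? 0ℤ)) ∎
  where open ≡-Reasoning
floor-/ℕ d c -[1+ m ] e -d≤t _ = trans
  (proj₁ (div-mod-unique d (c ℤ.- 1ℤ) (d ∸ suc m) (∸-monoʳ-< {o = 0} (s≤s z≤n) m<d) (trans e borrow)))
  (cong (λ b → c ℤ.- + bit b) (sym (dec-true (-[1+ m ] ℤ.<? 0ℤ) -<+)))
  where
  open ≡-Reasoning
  m<d : suc m ≤ d
  m<d = drop-neg d -d≤t
    where
    drop-neg : ∀ d → ℤ.- + d ℤ.≤ -[1+ m ] → suc m ≤ d
    drop-neg (suc d) (-≤- m≤d) = s≤s m≤d
  borrow : c ℤ.* + d ℤ.+ -[1+ m ] ≡ (c ℤ.- 1ℤ) ℤ.* + d ℤ.+ + (d ∸ suc m)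
  borrow = begin
    c ℤ.* + d ℤ.+ ℤ.- + suc m                  ≡⟨ shift c (+ d) (+ suc m) ⟩
    (c ℤ.- 1ℤ) ℤ.* + d ℤ.+ (+ d ℤ.- + suc m)   ≡⟨ cong (λ t → (c ℤ.- 1ℤ) ℤ.* + d ℤ.+ t) (+∸+ d (suc m) m<d) ⟩
    (c ℤ.- 1ℤ) ℤ.* + d ℤ.+ + (d ∸ suc m) ∎
    where
    shift : ∀ c d t → c ℤ.* d ℤ.+ ℤ.- t ≡ (c ℤ.- 1ℤ) ℤ.* d ℤ.+ (d ℤ.- t)
    shift = ℤ-solve

-- Signed residues modulo N = 2n+2

module SignedResidue (n : ℕ) where

  N≡ : N n ≡ suc n + suc n
  N≡ = double n
    where
    double : ∀ n → 2 + 2 * n ≡ suc n + suc n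
    double = ℕ-solve

  +N≡ : + N n ≡ + suc n ℤ.+ + suc n
  +N≡ = trans (cong +_ N≡) (ℤP.pos-+ (suc n) (suc n))

  InRange : ℤ → Set
  InRange s = ℤ.- + suc n ℤ.≤ s × s ℤ.≤ + n

  inRange : ∀ {s} → ℤ.- + n ℤ.≤ s × s ℤ.≤ + n → InRange s
  inRange (lo , hi) = ℤP.≤-trans (ℤP.neg-mono-≤ (+≤+ (n≤1+n n))) lo , hi

  small-inRange : ∀ {s s′} → InRange s → InRange s′ → Small (N n) (s′ ℤ.- s)
  small-inRange (lo≤s , s≤n) (lo≤s′ , s′≤n) = small-window (N n) lo≤s (below s≤n) lo≤s′ (below s′≤n)
    where
    top : ℤ.- + suc n ℤ.+ + N n ≡ + suc n
    top = trans (cong (λ t → ℤ.- + suc n ℤ.+ t) +N≡) (neg-+-cancel (+ suc n) (+ suc n))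
    below : ∀ {s} → s ℤ.≤ + n → s ℤ.< ℤ.- + suc n ℤ.+ + N n
    below s≤n = subst (_ ℤ.<_) (sym top) (ℤP.≤-<-trans s≤n (+<+ (n<1+n n)))

  sigma-≤ : ∀ x → x %ℕ N n ≤ n → sigma n x ≡ + (x %ℕ N n)
  sigma-≤ x r≤n with (x %ℕ N n) ≤? n
  ... | yes _   = refl
  ... | no r≰n = ⊥-elim (r≰n r≤n)

  sigma-> : ∀ x → ¬ (x %ℕ N n ≤ n) → sigma n x ≡ + (x %ℕ N n) ℤ.- + N n
  sigma-> x r≰n with (x %ℕ N n) ≤? n
  ... | yes r≤n = ⊥-elim (r≰n r≤n)
  ... | no _    = refl

  coef-of : ∀ {x} q → x ℤ.- sigma n x ≡ q ℤ.* + N n → coef n x ≡ q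
  coef-of {x} q e = proj₁ (div-mod-unique (N n) {x ℤ.- sigma n x} q 0 (s≤s z≤n) (trans e (sym (ℤP.+-identityʳ _))))

  sigma-coef : ∀ x → x ≡ coef n x ℤ.* + N n ℤ.+ sigma n x × InRange (sigma n x)
  sigma-coef x with does-view ((x %ℕ N n) ≤? n)
  ... | inj₁ (r≤n , _) = subst (λ t → x ≡ coef n x ℤ.* + N n ℤ.+ t × InRange t) (sym (sigma-≤ x r≤n))
                           (split , ℤP.≤-trans ℤP.neg-≤-pos (0≤+ r) , +≤+ r≤n)
    where
    r = x %ℕ N n
    q = x /ℕ N n
    split : x ≡ coef n x ℤ.* + N n ℤ.+ + r
    split = begin
      x                        ≡⟨ a≡a%ℕn+[a/ℕn]*n x (N n) ⟩
      + r ℤ.+ q ℤ.* + N n      ≡⟨ ℤP.+-comm (+ r) (q ℤ.* + N n) ⟩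
      q ℤ.* + N n ℤ.+ + r      ≡⟨ cong (λ t → t ℤ.* + N n ℤ.+ + r) (sym (coef-of {x} q quotient)) ⟩
      coef n x ℤ.* + N n ℤ.+ + r ∎
      where
      open ≡-Reasoning
      quotient : x ℤ.- sigma n x ≡ q ℤ.* + N n
      quotient = trans (cong (λ t → x ℤ.- t) (sigma-≤ x r≤n))
                   (trans (cong (ℤ._- + r) (a≡a%ℕn+[a/ℕn]*n x (N n))) (cancel (+ r) (q ℤ.* + N n)))
        where
        cancel : ∀ a b → a ℤ.+ b ℤ.- a ≡ b
        cancel = ℤ-solve
  ... | inj₂ (r≰n , _) = subst (λ t → x ≡ coef n x ℤ.* + N n ℤ.+ t × InRange t) (sym (sigma-> x r≰n))
                           (split , lower , upper)
    where
    r = x %ℕ N n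
    q = x /ℕ N n
    split : x ≡ coef n x ℤ.* + N n ℤ.+ (+ r ℤ.- + N n)
    split = begin
      x                                     ≡⟨ a≡a%ℕn+[a/ℕn]*n x (N n) ⟩
      + r ℤ.+ q ℤ.* + N n                   ≡⟨ carry (+ r) q (+ N n) ⟩
      (q ℤ.+ 1ℤ) ℤ.* + N n ℤ.+ (+ r ℤ.- + N n) ≡⟨ cong (λ t → t ℤ.* + N n ℤ.+ (+ r ℤ.- + N n)) (sym (coef-of {x} (q ℤ.+ 1ℤ) quotient)) ⟩
      coef n x ℤ.* + N n ℤ.+ (+ r ℤ.- + N n) ∎
      where
      open ≡-Reasoning
      carry : ∀ r q m → r ℤ.+ q ℤ.* m ≡ (q ℤ.+ 1ℤ) ℤ.* m ℤ.+ (r ℤ.- m)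
      carry = ℤ-solve
      quotient : x ℤ.- sigma n x ≡ (q ℤ.+ 1ℤ) ℤ.* + N n
      quotient = trans (cong (λ t → x ℤ.- t) (sigma-> x r≰n))
                   (trans (cong (ℤ._- (+ r ℤ.- + N n)) (a≡a%ℕn+[a/ℕn]*n x (N n))) (cancel (+ r) q (+ N n)))
        where
        cancel : ∀ a q m → a ℤ.+ q ℤ.* m ℤ.- (a ℤ.- m) ≡ (q ℤ.+ 1ℤ) ℤ.* m
        cancel = ℤ-solve
    lower : ℤ.- + suc n ℤ.≤ + r ℤ.- + N n
    lower = begin
      ℤ.- + suc n                         ≡⟨ shift (+ suc n) ⟩
      + suc n ℤ.- (+ suc n ℤ.+ + suc n)   ≡⟨ cong (λ t → + suc n ℤ.- t) (sym +N≡) ⟩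
      + suc n ℤ.- + N n                   ≤⟨ ℤP.+-monoˡ-≤ (ℤ.- + N n) (+≤+ (≰⇒> r≰n)) ⟩
      + r ℤ.- + N n ∎
      where
      open ℤP.≤-Reasoning
      shift : ∀ a → ℤ.- a ≡ a ℤ.- (a ℤ.+ a)
      shift = ℤ-solve
    upper : + r ℤ.- + N n ℤ.≤ + n
    upper = ℤP.≤-trans (ℤP.<⇒≤ (subst (+ r ℤ.- + N n ℤ.<_) (ℤP.+-inverseʳ (+ N n))
                                   (ℤP.+-monoˡ-< (ℤ.- + N n) (+<+ (n%ℕd<d x (N n))))))
                       (0≤+ n)

  sigma-coef-unique : ∀ {x} c s → x ≡ c ℤ.* + N n ℤ.+ s → InRange s → sigma n x ≡ s × coef n x ≡ c
  sigma-coef-unique {x} c s e s∈ with sigma-coef x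
  ... | split , σ∈ with lex-unique (N n) {coef n x} {c} {sigma n x} {s} (small-inRange σ∈ s∈) (trans (sym split) e)
  ...   | c≡ , σ≡ = σ≡ , c≡

  %ℕ-of-split : ∀ {x} c s → x ≡ c ℤ.* + N n ℤ.+ s → x %ℕ N n ≡ s %ℕ N n
  %ℕ-of-split {x} c s e = %ℕ-shift (N n) {x} {s} c (trans e (ℤP.+-comm _ s))

  %ℕ-injective : ∀ {s s′} → InRange s → InRange s′ → s %ℕ N n ≡ s′ %ℕ N n → s ≡ s′
  %ℕ-injective {s} {s′} s∈ s′∈ e = proj₂ (lex-unique (N n) {ℤ.- (s /ℕ N n)} {ℤ.- (s′ /ℕ N n)} {s} {s′} (small-inRange s∈ s′∈)
    (trans (unsplit s) (trans (cong +_ e) (sym (unsplit s′)))))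
    where
    unsplit : ∀ t → ℤ.- (t /ℕ N n) ℤ.* + N n ℤ.+ t ≡ + (t %ℕ N n)
    unsplit t = trans (cong (λ u → ℤ.- (t /ℕ N n) ℤ.* + N n ℤ.+ u) (a≡a%ℕn+[a/ℕn]*n t (N n)))
                      (cancel (+ (t %ℕ N n)) (t /ℕ N n) (+ N n))
      where
      cancel : ∀ r q m → ℤ.- q ℤ.* m ℤ.+ (r ℤ.+ q ℤ.* m) ≡ r
      cancel = ℤ-solve

ψ-max : ℕ → ℕ
ψ-max k = 2 * suc k ∸ 1

-- the k-th entry of Ψ(σ) (0-indexed), from the sign of σ_k and e*_k
ψ-entry : ℕ → ℤ → ℕ → ℕ
ψ-entry k s e* = if does (0ℤ ℤ.<? s) then e* else ψ-max k ∸ e*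

ψ : (ℕ → ℤ) → ℕ → ℕ
ψ S k = ψ-entry k (S k) (code (∣_∣ ∘ S) k)

IsSignedPermutation : ℕ → (ℕ → ℤ) → Set
IsSignedPermutation n S = IsPermutation n (∣_∣ ∘ S)

ψ-max-suc : ∀ k → ψ-max (suc k) ≡ 2 + ψ-max k
ψ-max-suc k = cong suc (+-suc k (suc (k + 0)))

k<ψ-max∸ : ∀ k c → c ≤ k → suc k ≤ ψ-max k ∸ c
k<ψ-max∸ k c c≤k = begin
  suc k                  ≡⟨ cong suc (sym (+-identityʳ k)) ⟩
  suc (k + 0)            ≤⟨ m≤n+m _ (k ∸ c) ⟩
  k ∸ c + suc (k + 0)    ≡⟨ sym (+-∸-comm (suc (k + 0)) c≤k) ⟩
  ψ-max k ∸ c ∎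
  where open ≤-Reasoning

ψ-max-suc∸ : ∀ k c c′ → c ≤ k → suc c ≤ c′ → ψ-max (suc k) ∸ c′ ≤ suc (ψ-max k ∸ c)
ψ-max-suc∸ k c c′ c≤k c<c′ = begin
  ψ-max (suc k) ∸ c′        ≤⟨ ∸-monoʳ-≤ (ψ-max (suc k)) c<c′ ⟩
  ψ-max (suc k) ∸ suc c     ≡⟨ cong (_∸ suc c) (ψ-max-suc k) ⟩
  suc (suc (ψ-max k)) ∸ suc c ≡⟨ +-∸-assoc 1 (≤-trans c≤k (m≤m+n k _)) ⟩
  suc (ψ-max k ∸ c) ∎
  where open ≤-Reasoning

ψ-entry≤ψ-max : ∀ k s c → c ≤ k → ψ-entry k s c ≤ ψ-max k
ψ-entry≤ψ-max k s c c≤k with does (0ℤ ℤ.<? s)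
... | true  = ≤-trans c≤k (m≤m+n k _)
... | false = m∸n≤m (ψ-max k) c

-- The hypotheses on c and c′ are what code-suc-≤ and code-suc-> give for consecutive entries.
ψ-entry-< : ∀ k (s t : ℤ) (c c′ : ℕ) → s ≢ 0ℤ → t ≢ 0ℤ → c ≤ k → c′ ≤ suc k →
  (∣ s ∣ < ∣ t ∣ → c′ ≤ c) → (∣ t ∣ < ∣ s ∣ → suc c ≤ c′) →
  s ℤ.< t → suc k * ψ-entry (suc k) t c′ ≤ suc (suc k) * ψ-entry k s c
ψ-entry-< k (+ zero)  t          c c′ s≢0 _ _ _ _ _ _ = ⊥-elim (s≢0 refl)
ψ-entry-< k s         (+ zero)   c c′ _ t≢0 _ _ _ _ _ = ⊥-elim (t≢0 refl)
ψ-entry-< k (+ suc a) (+ suc b)  c c′ _ _ c≤k c′≤ up down (+<+ a<b) =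
  ≤-trans (*-monoʳ-≤ (suc k) (up a<b)) (*-monoˡ-≤ c (n≤1+n (suc k)))
ψ-entry-< k -[1+ a ] (+ suc b)   c c′ _ _ c≤k c′≤ up down _ =
  *-mono-≤ (n≤1+n (suc k)) (≤-trans c′≤ (k<ψ-max∸ k c c≤k))
ψ-entry-< k -[1+ a ] -[1+ b ]    c c′ _ _ c≤k c′≤ up down (-<- b<a) = begin
  suc k * (ψ-max (suc k) ∸ c′) ≤⟨ *-monoʳ-≤ (suc k) (ψ-max-suc∸ k c c′ c≤k (down (s≤s b<a))) ⟩
  suc k * suc e                ≡⟨ *-suc (suc k) e ⟩
  suc k + suc k * e            ≤⟨ +-monoˡ-≤ (suc k * e) (k<ψ-max∸ k c c≤k) ⟩
  e + suc k * e ∎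
  where
  open ≤-Reasoning
  e = ψ-max k ∸ c

ψ-entry-> : ∀ k (s t : ℤ) (c c′ : ℕ) → s ≢ 0ℤ → t ≢ 0ℤ → c ≤ k → c′ ≤ suc k →
  (∣ s ∣ < ∣ t ∣ → c′ ≤ c) → (∣ t ∣ < ∣ s ∣ → suc c ≤ c′) →
  t ℤ.< s → suc (suc k) * ψ-entry k s c < suc k * ψ-entry (suc k) t c′
ψ-entry-> k (+ zero)  t          c c′ s≢0 _ _ _ _ _ _ = ⊥-elim (s≢0 refl)
ψ-entry-> k s         (+ zero)   c c′ _ t≢0 _ _ _ _ _ = ⊥-elim (t≢0 refl)
ψ-entry-> k (+ suc a) (+ suc b)  c c′ _ _ c≤k c′≤ up down (+<+ b<a) = begin-strict
  c + suc k * c       <⟨ +-monoˡ-< (suc k * c) (s≤s c≤k) ⟩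
  suc k + suc k * c   ≡⟨ sym (*-suc (suc k) c) ⟩
  suc k * suc c       ≤⟨ *-monoʳ-≤ (suc k) (down b<a) ⟩
  suc k * c′ ∎
  where open ≤-Reasoning
ψ-entry-> k (+ suc a) -[1+ b ]   c c′ _ _ c≤k c′≤ up down _ = begin-strict
  suc (suc k) * c               ≤⟨ *-monoʳ-≤ (suc (suc k)) c≤k ⟩
  suc (suc k) * k               <⟨ *-monoʳ-< (suc (suc k)) (n<1+n k) ⟩
  suc (suc k) * suc k           ≡⟨ *-comm (suc (suc k)) (suc k) ⟩
  suc k * suc (suc k)           ≤⟨ *-monoʳ-≤ (suc k) (k<ψ-max∸ (suc k) c′ c′≤) ⟩
  suc k * (ψ-max (suc k) ∸ c′) ∎
  where open ≤-Reasoning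
ψ-entry-> k -[1+ a ] -[1+ b ]    c c′ _ _ c≤k c′≤ up down (-<- a<b) = begin-strict
  suc (suc k) * e          ≡⟨ +-comm e (suc k * e) ⟩
  suc k * e + e            <⟨ +-monoʳ-< (suc k * e) e<2+2k ⟩
  suc k * e + suc k * 2    ≡⟨ sym (*-distribˡ-+ (suc k) e 2) ⟩
  suc k * (e + 2)          ≡⟨ cong (suc k *_) (+-comm e 2) ⟩
  suc k * (2 + e)          ≤⟨ *-monoʳ-≤ (suc k) two-more ⟩
  suc k * (ψ-max (suc k) ∸ c′) ∎
  where
  open ≤-Reasoning
  e = ψ-max k ∸ c
  e<2+2k : e < suc k * 2
  e<2+2k = subst (e <_) (*-comm 2 (suc k)) (s≤s (m∸n≤m (ψ-max k) c))
  two-more : 2 + e ≤ ψ-max (suc k) ∸ c′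
  two-more = begin
    2 + (ψ-max k ∸ c)         ≡⟨ sym (+-∸-assoc 2 (≤-trans c≤k (m≤m+n k _))) ⟩
    (2 + ψ-max k) ∸ c         ≡⟨ cong (_∸ c) (sym (ψ-max-suc k)) ⟩
    ψ-max (suc k) ∸ c         ≤⟨ ∸-monoʳ-≤ (ψ-max (suc k)) (up (s≤s a<b)) ⟩
    ψ-max (suc k) ∸ c′ ∎

ψ≤ψ-max : ∀ S k → ψ S k ≤ ψ-max k
ψ≤ψ-max S k = ψ-entry≤ψ-max k (S k) _ (code≤ (∣_∣ ∘ S) k)

module SignedPermutation {n : ℕ} {S : ℕ → ℤ} (perm : IsSignedPermutation n S) where

  S≢0 : ∀ {k} → k < n → S k ≢ 0ℤ
  S≢0 {k} k<n e with proj₁ (proj₂ perm k k<n)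
  ... | 1≤∣S∣ rewrite e with () ← 1≤∣S∣

  S-bounds : ∀ {k} → k < n → ℤ.- + n ℤ.≤ S k × S k ℤ.≤ + n
  S-bounds {k} k<n = bounds (S k) (proj₂ (proj₂ perm k k<n))
    where
    bounds : ∀ s → ∣ s ∣ ≤ n → ℤ.- + n ℤ.≤ s × s ℤ.≤ + n
    bounds (+ m)    m≤n = ℤP.≤-trans ℤP.neg-≤-pos (0≤+ m) , +≤+ m≤n
    bounds -[1+ m ] m<n = ℤP.neg-mono-≤ (+≤+ m<n) , -≤+

  ψ-step-iff : ∀ {k} → suc k < n →
    S k ℤ.< S (suc k) ⇔ ψ S (suc k) * suc k ≤ ψ S k * suc (suc k)
  ψ-step-iff {k} k+1<n = mk⇔
    (λ lt → subst₂ _≤_ (*-comm (suc k) (ψ S (suc k))) (*-comm (suc (suc k)) (ψ S k)) (increasing lt))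
    from
    where
    k<n = <-trans (n<1+n k) k+1<n
    A = ∣_∣ ∘ S
    c = code A k
    c′ = code A (suc k)
    increasing = ψ-entry-< k (S k) (S (suc k)) c c′ (S≢0 k<n) (S≢0 k+1<n) (code≤ A k) (code≤ A (suc k))
                           (code-suc-≤ A k) (code-suc-> A k)
    decreasing = ψ-entry-> k (S k) (S (suc k)) c c′ (S≢0 k<n) (S≢0 k+1<n) (code≤ A k) (code≤ A (suc k))
                           (code-suc-≤ A k) (code-suc-> A k)
    from : ψ S (suc k) * suc k ≤ ψ S k * suc (suc k) → S k ℤ.< S (suc k)
    from le with ℤP.<-cmp (S k) (S (suc k))
    ... | tri< lt _ _ = lt
    ... | tri≈ _ eq _ = ⊥-elim (<⇒≢ (n<1+n k) (proj₁ perm k (suc k) k<n k+1<n (cong ∣_∣ eq)))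
    ... | tri> _ _ gt = ⊥-elim (<⇒≱ (decreasing gt) (subst₂ _≤_ (*-comm (ψ S (suc k)) (suc k)) (*-comm (ψ S k) (suc (suc k))) le))

  ψ-zero-iff : 0 < n → 0ℤ ℤ.< S 0 ⇔ ψ S 0 ≡ 0
  ψ-zero-iff 0<n with S 0 | S≢0 0<n
  ... | + zero    | S0≢0 = ⊥-elim (S0≢0 refl)
  ... | + suc _   | _    = mk⇔ (λ _ → refl) (λ _ → +<+ (s≤s z≤n))
  ... | -[1+ _ ]  | _    = mk⇔ (λ ()) (λ ())

⊎-×-cong : ∀ {A B P Q : Set} → P ⇔ Q → (A ⊎ (B × P)) ⇔ (A ⊎ (B × Q))
⊎-×-cong P⇔Q = mk⇔ (Sum.map₂ (Prod.map₂ (Equivalence.to P⇔Q))) (Sum.map₂ (Prod.map₂ (Equivalence.from P⇔Q)))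

≤-cong-⇔ : ∀ {a a′ b b′} → a ≡ a′ → b ≡ b′ → a ℤ.≤ b ⇔ a′ ℤ.≤ b′
≤-cong-⇔ refl refl = mk⇔ id id

<-cong-⇔ : ∀ {a a′ b b′} → a ≡ a′ → b ≡ b′ → a ℤ.< b ⇔ a′ ℤ.< b′
<-cong-⇔ refl refl = mk⇔ id id

-+≤-+⇔ : ∀ {a b} → ℤ.- + a ℤ.≤ ℤ.- + b ⇔ b ≤ a
-+≤-+⇔ = mk⇔ (ℤP.drop‿+≤+ ∘ ℤP.neg-cancel-≤) (ℤP.neg-mono-≤ ∘ +≤+)

0≤-+⇔≡0 : ∀ {e} → 0ℤ ℤ.≤ ℤ.- + e ⇔ e ≡ 0
0≤-+⇔≡0 {zero}  = mk⇔ (λ _ → refl) (λ _ → +≤+ z≤n)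
0≤-+⇔≡0 {suc e} = mk⇔ (λ ()) (λ ())

PositiveIncreasing : ℕ → (ℕ → ℤ) → Set
PositiveIncreasing n W = (0 < n → 0ℤ ℤ.< W 0) × (∀ k → suc k < n → W k ℤ.< W (suc k))

LectureHall : ℕ → (ℕ → ℤ) → Set
LectureHall n L = (0 < n → 0ℤ ℤ.≤ L 0) × (∀ k → suc k < n → L k ℤ.* + suc (suc k) ℤ.≤ L (suc k) ℤ.* + suc k)

-- Λ C S k is λ_{k+1} = 2(k+1) c_{k+1} − e_{k+1} in the paper's 1-based notation.
Λ : (ℕ → ℤ) → (ℕ → ℤ) → ℕ → ℤ
Λ C S k = + (2 * suc k) ℤ.* C k ℤ.- + ψ S k

scale-Λ : ∀ d c e m → (+ d ℤ.* c ℤ.- + e) ℤ.* + m ≡ c ℤ.* + (d * m) ℤ.+ ℤ.- + (e * m)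
scale-Λ d c e m = trans (expand (+ d) c (+ e) (+ m))
  (cong₂ (λ dm em → c ℤ.* dm ℤ.+ ℤ.- em) (sym (ℤP.pos-* d m)) (sym (ℤP.pos-* e m)))
  where
  expand : ∀ d c e m → (d ℤ.* c ℤ.- e) ℤ.* m ≡ c ℤ.* (d ℤ.* m) ℤ.+ ℤ.- (e ℤ.* m)
  expand = ℤ-solve

-- Both comparisons are lexicographic, first on C, then on S (for W) or on the
-- scaled ψ (for Λ); ψ-step-iff matches the two tie-breakers.
module WindowOrder {n : ℕ} (W C S : ℕ → ℤ) (split : ∀ {k} → k < n → W k ≡ C k ℤ.* + N n ℤ.+ S k)
                   (perm : IsSignedPermutation n S) where
  open SignedPermutation {n} {S} perm
  open SignedResidue n

  positive-iff : 0 < n → 0ℤ ℤ.< W 0 ⇔ 0ℤ ℤ.≤ Λ C S 0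
  positive-iff 0<n = begin
    0ℤ ℤ.< W 0                                        ∼⟨ <-cong-⇔ refl (split 0<n) ⟩
    0ℤ ℤ.* + N n ℤ.+ 0ℤ ℤ.< C 0 ℤ.* + N n ℤ.+ S 0     ∼⟨ lex-<-iff (N n) (small-inRange (ℤP.neg-≤-pos , 0≤+ n) (inRange (S-bounds 0<n))) ⟩
    (0ℤ ℤ.< C 0 ⊎ (0ℤ ≡ C 0 × 0ℤ ℤ.< S 0))            ∼⟨ ⊎-×-cong (ψ-zero-iff 0<n) ⟩
    (0ℤ ℤ.< C 0 ⊎ (0ℤ ≡ C 0 × ψ S 0 ≡ 0))             ∼⟨ ⊎-×-cong (⇔.sym 0≤-+⇔≡0) ⟩
    (0ℤ ℤ.< C 0 ⊎ (0ℤ ≡ C 0 × 0ℤ ℤ.≤ ℤ.- + ψ S 0))    ∼⟨ ⇔.sym (lex-≤-iff 2 small) ⟩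
    0ℤ ℤ.* + 2 ℤ.+ 0ℤ ℤ.≤ C 0 ℤ.* + 2 ℤ.+ ℤ.- + ψ S 0 ∼⟨ ≤-cong-⇔ refl (sym (Λ-split (C 0) (+ ψ S 0))) ⟩
    0ℤ ℤ.≤ Λ C S 0 ∎
    where
    open EquationalReasoning {k = equivalence}
    small : Small 2 (ℤ.- + ψ S 0 ℤ.- 0ℤ)
    small = subst (Small 2) (drop-zero (+ ψ S 0)) (small-∸ {2} {0} (s≤s z≤n) (s≤s (ψ≤ψ-max S 0)))
      where
      drop-zero : ∀ e → 0ℤ ℤ.- e ≡ ℤ.- e ℤ.- 0ℤ
      drop-zero = ℤ-solve
    Λ-split : ∀ c e → + 2 ℤ.* c ℤ.- e ≡ c ℤ.* + 2 ℤ.+ ℤ.- e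
    Λ-split = ℤ-solve

  increasing-iff : ∀ {k} → suc k < n →
    W k ℤ.< W (suc k) ⇔ Λ C S k ℤ.* + suc (suc k) ℤ.≤ Λ C S (suc k) ℤ.* + suc k
  increasing-iff {k} k+1<n = begin
    W k ℤ.< W (suc k)
      ∼⟨ <-cong-⇔ (split k<n) (split k+1<n) ⟩
    C k ℤ.* + N n ℤ.+ S k ℤ.< C (suc k) ℤ.* + N n ℤ.+ S (suc k)
      ∼⟨ lex-<-iff (N n) (small-inRange (inRange (S-bounds k<n)) (inRange (S-bounds k+1<n))) ⟩
    (C k ℤ.< C (suc k) ⊎ (C k ≡ C (suc k) × S k ℤ.< S (suc k)))
      ∼⟨ ⊎-×-cong (ψ-step-iff k+1<n) ⟩
    (C k ℤ.< C (suc k) ⊎ (C k ≡ C (suc k) × e′ * suc k ≤ e * suc (suc k)))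
      ∼⟨ ⊎-×-cong (⇔.sym -+≤-+⇔) ⟩
    (C k ℤ.< C (suc k) ⊎ (C k ≡ C (suc k) × ℤ.- + (e * suc (suc k)) ℤ.≤ ℤ.- + (e′ * suc k)))
      ∼⟨ ⇔.sym (lex-≤-iff M small) ⟩
    C k ℤ.* + M ℤ.+ ℤ.- + (e * suc (suc k)) ℤ.≤ C (suc k) ℤ.* + M ℤ.+ ℤ.- + (e′ * suc k)
      ∼⟨ ≤-cong-⇔ (sym (scale-Λ (2 * suc k) (C k) e (suc (suc k))))
                  (sym (trans (scale-Λ (2 * suc (suc k)) (C (suc k)) e′ (suc k))
                              (cong (λ m → C (suc k) ℤ.* + m ℤ.+ ℤ.- + (e′ * suc k)) M′≡M))) ⟩
    Λ C S k ℤ.* + suc (suc k) ℤ.≤ Λ C S (suc k) ℤ.* + suc k ∎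
    where
    open EquationalReasoning {k = equivalence}
    k<n = <-trans (n<1+n k) k+1<n
    e = ψ S k
    e′ = ψ S (suc k)
    M = 2 * suc k * suc (suc k)
    M′≡M : 2 * suc (suc k) * suc k ≡ M
    M′≡M = reorder k
      where
      reorder : ∀ k → 2 * suc (suc k) * suc k ≡ 2 * suc k * suc (suc k)
      reorder = ℕ-solve
    e<M : e * suc (suc k) < M
    e<M = *-monoˡ-< (suc (suc k)) (s≤s (ψ≤ψ-max S k))
    e′<M : e′ * suc k < M
    e′<M = subst (e′ * suc k <_) M′≡M (*-monoˡ-< (suc k) (s≤s (ψ≤ψ-max S (suc k))))
    small : Small M (ℤ.- + (e′ * suc k) ℤ.- ℤ.- + (e * suc (suc k)))
    small = subst (Small M) (swap-neg (+ (e * suc (suc k))) (+ (e′ * suc k))) (small-∸ e<M e′<M)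
      where
      swap-neg : ∀ a b → a ℤ.- b ≡ ℤ.- b ℤ.- ℤ.- a
      swap-neg = ℤ-solve

  positiveIncreasing⇔lectureHall : PositiveIncreasing n W ⇔ LectureHall n (Λ C S)
  positiveIncreasing⇔lectureHall = mk⇔
    (Prod.map (λ h 0<n → Equivalence.to (positive-iff 0<n) (h 0<n)) (λ h k p → Equivalence.to (increasing-iff p) (h k p)))
    (Prod.map (λ h 0<n → Equivalence.from (positive-iff 0<n) (h 0<n)) (λ h k p → Equivalence.from (increasing-iff p) (h k p)))

at : ∀ {n} → Vec ℤ n → ℕ → ℤ
at []       j       = 0ℤ
at (x ∷ xs) zero    = x
at (x ∷ xs) (suc j) = at xs j

at-lookup : ∀ {n} (w : Vec ℤ n) (i : Fin n) → at w (toℕ i) ≡ lookup w i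
at-lookup (x ∷ w) fzero    = refl
at-lookup (x ∷ w) (fsuc i) = at-lookup w i

at-fromℕ< : ∀ {n} (w : Vec ℤ n) {k} (k<n : k < n) → at w k ≡ lookup w (fromℕ< k<n)
at-fromℕ< w {k} k<n = trans (cong (at w) (sym (toℕ-fromℕ< k<n))) (at-lookup w (fromℕ< k<n))

at-tabulate : ∀ {n} (f : ℕ → ℤ) k → k < n → at (tabulate {n = n} (f ∘ toℕ)) k ≡ f k
at-tabulate {suc n} f zero    _         = refl
at-tabulate {suc n} f (suc k) (s≤s k<n) = at-tabulate (f ∘ suc) k k<n

at-injective : ∀ {n} (w w′ : Vec ℤ n) → (∀ k → k < n → at w k ≡ at w′ k) → w ≡ w′
at-injective []      []        _ = refl
at-injective (x ∷ w) (x′ ∷ w′) h = cong₂ _∷_ (h 0 (s≤s z≤n)) (at-injective w w′ (λ k k<n → h (suc k) (s≤s k<n)))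

first-fin⇔ : ∀ {n} (v : Vec ℤ n) (P : ℤ → Set) → (∀ (i : Fin n) → toℕ i ≡ 0 → P (lookup v i)) ⇔ (0 < n → P (at v 0))
first-fin⇔ v P = mk⇔
  (λ h 0<n → subst P (sym (at-fromℕ< v 0<n)) (h (fromℕ< 0<n) (toℕ-fromℕ< 0<n)))
  (λ h i i≡0 → subst P (trans (cong (at v) (sym i≡0)) (at-lookup v i)) (h (subst (_< _) i≡0 (toℕ<n i))))

adjacent-fin⇔ : ∀ {n} (v : Vec ℤ n) (R : ℕ → ℤ → ℤ → Set) →
  (∀ (i j : Fin n) → toℕ j ≡ suc (toℕ i) → R (toℕ i) (lookup v i) (lookup v j)) ⇔
  (∀ k → suc k < n → R k (at v k) (at v (suc k)))
adjacent-fin⇔ {n} v R = mk⇔ to from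
  where
  to : (∀ (i j : Fin n) → toℕ j ≡ suc (toℕ i) → R (toℕ i) (lookup v i) (lookup v j)) →
       ∀ k → suc k < n → R k (at v k) (at v (suc k))
  to h k k+1<n = subst₂ (R k) (sym (at-fromℕ< v k<n)) (sym (at-fromℕ< v k+1<n))
    (subst (λ m → R m (lookup v (fromℕ< k<n)) (lookup v (fromℕ< k+1<n))) (toℕ-fromℕ< k<n)
      (h (fromℕ< k<n) (fromℕ< k+1<n) (trans (toℕ-fromℕ< k+1<n) (cong suc (sym (toℕ-fromℕ< k<n))))))
    where k<n = <-trans (n<1+n k) k+1<n
  from : (∀ k → suc k < n → R k (at v k) (at v (suc k))) →
         ∀ (i j : Fin n) → toℕ j ≡ suc (toℕ i) → R (toℕ i) (lookup v i) (lookup v j)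
  from h i j j≡ = subst₂ (R (toℕ i)) (at-lookup v i) (trans (cong (at v) (sym j≡)) (at-lookup v j))
    (h (toℕ i) (subst (_< n) j≡ (toℕ<n j)))

sumℤ : (ℕ → ℤ) → ℕ → ℤ
sumℤ f zero    = 0ℤ
sumℤ f (suc k) = sumℤ f k ℤ.+ f k

sumℤ-cong : ∀ {f g} k → (∀ j → j < k → f j ≡ g j) → sumℤ f k ≡ sumℤ g k
sumℤ-cong zero    h = refl
sumℤ-cong (suc k) h = cong₂ ℤ._+_ (sumℤ-cong k (λ j p → h j (m<n⇒m<1+n p))) (h k ≤-refl)

sumℤ-front : ∀ f m → sumℤ f (suc m) ≡ f 0 ℤ.+ sumℤ (f ∘ suc) m
sumℤ-front f zero    = trans (ℤP.+-identityˡ (f 0)) (sym (ℤP.+-identityʳ (f 0)))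
sumℤ-front f (suc m) = trans (cong (ℤ._+ f (suc m)) (sumℤ-front f m)) (ℤP.+-assoc (f 0) _ _)

count-front : ∀ P m → count P (suc m) ≡ bit (P 0) + count (P ∘ suc) m
count-front P zero    = +-comm 0 (bit (P 0))
count-front P (suc m) = trans (cong (_+ bit (P (suc m))) (count-front P m)) (+-assoc (bit (P 0)) _ _)

∑-filter≡sumℤ : ∀ {X : Set} {P : X → Set} (P? : ∀ x → Dec (P x)) (g : X → ℤ) m (f : Fin m → X) (G : ℕ → ℤ) →
  (∀ j → (if does (P? (f j)) then g (f j) else 0ℤ) ≡ G (toℕ j)) → ∑ (filter P? (tabulateL f)) g ≡ sumℤ G m
∑-filter≡sumℤ P? g zero    f G h = refl
∑-filter≡sumℤ P? g (suc m) f G h with does (P? (f fzero)) | h fzero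
... | true  | h0 = trans (cong₂ ℤ._+_ h0 (∑-filter≡sumℤ P? g m (f ∘ fsuc) (G ∘ suc) (h ∘ fsuc))) (sym (sumℤ-front G m))
... | false | h0 = trans (trans (sym (ℤP.+-identityˡ _)) (cong₂ ℤ._+_ h0 (∑-filter≡sumℤ P? g m (f ∘ fsuc) (G ∘ suc) (h ∘ fsuc))))
                         (sym (sumℤ-front G m))

length-filter≡count : ∀ {X : Set} {P : X → Set} (P? : ∀ x → Dec (P x)) m (f : Fin m → X) (B : ℕ → Bool) →
  (∀ j → does (P? (f j)) ≡ B (toℕ j)) → length (filter P? (tabulateL f)) ≡ count B m
length-filter≡count P? zero    f B h = refl
length-filter≡count P? (suc m) f B h with does (P? (f fzero)) | h fzero
... | true  | h0 = trans (cong suc (length-filter≡count P? m (f ∘ fsuc) (B ∘ suc) (h ∘ fsuc)))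
                         (trans (cong (_+ count (B ∘ suc) m) (cong bit h0)) (sym (count-front B m)))
... | false | h0 = trans (length-filter≡count P? m (f ∘ fsuc) (B ∘ suc) (h ∘ fsuc))
                         (trans (cong (_+ count (B ∘ suc) m) (cong bit h0)) (sym (count-front B m)))

∑-cong : ∀ {A : Set} (xs : List A) {f g : A → ℤ} → (∀ x → f x ≡ g x) → ∑ xs f ≡ ∑ xs g
∑-cong []L       h = refl
∑-cong (x ∷L xs) h = cong₂ ℤ._+_ (h x) (∑-cong xs h)

count-beyond : ∀ {P} k → (∀ j → k ≤ j → P j ≡ false) → ∀ t → count P (t + k) ≡ count P k
count-beyond k h zero    = refl
count-beyond k h (suc t) rewrite h (t + k) (m≤n+m k t) = trans (+-identityʳ _) (count-beyond k h t)

sumℤ-beyond : ∀ {f} k → (∀ j → k ≤ j → f j ≡ 0ℤ) → ∀ t → sumℤ f (t + k) ≡ sumℤ f k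
sumℤ-beyond k h zero    = refl
sumℤ-beyond k h (suc t) rewrite h (t + k) (m≤n+m k t) = trans (ℤP.+-identityʳ _) (sumℤ-beyond k h t)

count-restrict : ∀ Q k n → k ≤ n → count (λ j → does (j <? k) ∧ Q j) n ≡ count Q k
count-restrict Q k n k≤n = begin
  count P n             ≡⟨ cong (count P) (sym (m∸n+n≡m k≤n)) ⟩
  count P (n ∸ k + k)   ≡⟨ count-beyond k (λ j k≤j → cong (_∧ Q j) (dec-false (j <? k) (≤⇒≯ k≤j))) (n ∸ k) ⟩
  count P k             ≡⟨ count-cong k (λ j j<k → cong (_∧ Q j) (dec-true (j <? k) j<k)) ⟩
  count Q k ∎
  where
  open ≡-Reasoning
  P = λ j → does (j <? k) ∧ Q j

sumℤ-restrict : ∀ F k n → k < n → sumℤ (λ j → if does (j ≤? k) then F j else 0ℤ) n ≡ sumℤ F (suc k)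
sumℤ-restrict F k n k<n = begin
  sumℤ P n                    ≡⟨ cong (sumℤ P) (sym (m∸n+n≡m k<n)) ⟩
  sumℤ P (n ∸ suc k + suc k)  ≡⟨ sumℤ-beyond (suc k) (λ j k<j → cong (if_then F j else 0ℤ) (dec-false (j ≤? k) (<⇒≱ k<j))) (n ∸ suc k) ⟩
  sumℤ P (suc k)              ≡⟨ sumℤ-cong (suc k) (λ j j≤k → cong (if_then F j else 0ℤ) (dec-true (j ≤? k) (≤-pred j≤k))) ⟩
  sumℤ F (suc k) ∎
  where
  open ≡-Reasoning
  P = λ j → if does (j ≤? k) then F j else 0ℤ

sgn : Bool → ℤ → ℤ
sgn true  x = x
sgn false x = ℤ.- x

sgn-split : ∀ b c s (m : ℤ) → sgn b (c ℤ.* m ℤ.+ s) ≡ sgn b c ℤ.* m ℤ.+ sgn b s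
sgn-split true  c s m = refl
sgn-split false c s m = negate c s m
  where
  negate : ∀ c s m → ℤ.- (c ℤ.* m ℤ.+ s) ≡ (ℤ.- c) ℤ.* m ℤ.+ ℤ.- s
  negate = ℤ-solve

∣sgn∣ : ∀ b s → ∣ sgn b s ∣ ≡ ∣ s ∣
∣sgn∣ true  s = refl
∣sgn∣ false s = ℤP.∣-i∣≡∣i∣ s

sgn-injectiveˡ : ∀ b b′ {s} → s ≢ 0ℤ → sgn b s ≡ sgn b′ s → b ≡ b′
sgn-injectiveˡ true  true  _ _ = refl
sgn-injectiveˡ false false _ _ = refl
sgn-injectiveˡ true  false {+ zero}  s≢0 _  = ⊥-elim (s≢0 refl)
sgn-injectiveˡ false true  {+ zero}  s≢0 _  = ⊥-elim (s≢0 refl)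
sgn-injectiveˡ true  false {+ suc _} _ ()
sgn-injectiveˡ true  false { -[1+ _ ]} _ ()
sgn-injectiveˡ false true  {+ suc _} _ ()
sgn-injectiveˡ false true  { -[1+ _ ]} _ ()

sgn-bounds : ∀ n b {s} → ℤ.- + n ℤ.≤ s × s ℤ.≤ + n → ℤ.- + n ℤ.≤ sgn b s × sgn b s ℤ.≤ + n
sgn-bounds n true  bounds = bounds
sgn-bounds n false (lo , hi) = ℤP.neg-mono-≤ hi , subst (ℤ.- _ ℤ.≤_) (ℤP.neg-involutive (+ n)) (ℤP.neg-mono-≤ lo)

∣∣≡⇒≡± : ∀ a b → ∣ a ∣ ≡ ∣ b ∣ → a ≡ b ⊎ a ≡ ℤ.- b
∣∣≡⇒≡± (+ zero)  (+ zero)      _    = inj₁ refl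
∣∣≡⇒≡± (+ suc x) (+ suc .x)    refl = inj₁ refl
∣∣≡⇒≡± (+ suc x) -[1+ .x ]     refl = inj₂ refl
∣∣≡⇒≡± -[1+ x ]  (+ suc .x)    refl = inj₂ refl
∣∣≡⇒≡± -[1+ x ]  -[1+ .x ]     refl = inj₁ refl

module Window {n : ℕ} (w : Vec ℤ n) where
  open SignedResidue n

  W : ℕ → ℤ
  W = at w

  S : ℕ → ℤ
  S k = sigma n (W k)

  C : ℕ → ℤ
  C k = coef n (W k)

  split : ∀ k → W k ≡ C k ℤ.* + N n ℤ.+ S k
  split k = proj₁ (sigma-coef (W k))

  S∈ : ∀ k → InRange (S k)
  S∈ k = proj₂ (sigma-coef (W k))

  signed-%ℕ : ∀ b (i : Fin n) → signed w (b , i) %ℕ N n ≡ sgn b (S (toℕ i)) %ℕ N n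
  signed-%ℕ b i = %ℕ-of-split (sgn b (C k)) (sgn b (S k))
    (trans (signed-sgn b) (trans (cong (sgn b) (trans (sym (at-lookup w i)) (split k))) (sgn-split b (C k) (S k) (+ N n))))
    where
    k = toℕ i
    signed-sgn : ∀ b → signed w (b , i) ≡ sgn b (lookup w i)
    signed-sgn true  = refl
    signed-sgn false = refl

  eStar≡code : ∀ (i : Fin n) → eStar (σOf w) i ≡ code (∣_∣ ∘ S) (toℕ i)
  eStar≡code i = trans
    (length-filter≡count _ n id (λ j → does (j <? toℕ i) ∧ does (∣ S (toℕ i) ∣ <? ∣ S j ∣))
      (λ j → cong₂ (λ a b → does (toℕ j <? toℕ i) ∧ does (∣ a ∣ <? ∣ b ∣)) (lookup-S i) (lookup-S j)))
    (count-restrict (λ j → does (∣ S (toℕ i) ∣ <? ∣ S j ∣)) (toℕ i) n (<⇒≤ (toℕ<n i)))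
    where
    lookup-S : ∀ (i : Fin n) → lookup (σOf w) i ≡ S (toℕ i)
    lookup-S i = trans (lookup-map i (sigma n) w) (cong (sigma n) (sym (at-lookup w i)))

  Ψ-entry : ∀ (i : Fin n) → lookup (Ψ (σOf w)) i ≡ + ψ S (toℕ i)
  Ψ-entry i = trans (lookup∘tabulate _ i) (by-sign (lookup-map i (sigma n) w) (eStar≡code i))
    where
    k = toℕ i
    by-sign : ∀ {s e} → s ≡ sigma n (lookup w i) → e ≡ code (∣_∣ ∘ S) k →
      (if does (0ℤ ℤ.<? s) then + e else + (2 * suc k) ℤ.- + 1 ℤ.- + e) ≡ + ψ S k
    by-sign refl refl rewrite sym (at-lookup w i) with does (0ℤ ℤ.<? S k)
    ... | true  = refl
    ... | false = trans (cong (ℤ._- + code (∣_∣ ∘ S) k) (+∸+ (2 * suc k) 1 (s≤s z≤n)))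
                        (+∸+ (ψ-max k) (code (∣_∣ ∘ S) k) (≤-trans (code≤ (∣_∣ ∘ S) k) (m≤m+n k _)))

  Φ-entry : ∀ (i : Fin n) → lookup (Φ w) i ≡ Λ C S (toℕ i)
  Φ-entry i = trans (lookup∘tabulate _ i)
    (cong₂ (λ c e → + (2 * suc (toℕ i)) ℤ.* c ℤ.- e)
      (trans (lookup-map i (coef n) w) (cong (coef n) (sym (at-lookup w i))))
      (Ψ-entry i))

  at-Φ : ∀ {k} → k < n → at (Φ w) k ≡ Λ C S k
  at-Φ {k} k<n = trans (at-fromℕ< (Φ w) k<n) (trans (Φ-entry (fromℕ< k<n)) (cong (Λ C S) (toℕ-fromℕ< k<n)))

  DistinctResidues : Set
  DistinctResidues = ∀ (p q : Bool × Fin n) → ¬ (p ≡ q) → ¬ (signed w p %ℕ N n ≡ signed w q %ℕ N n)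

  distinct⇒signedPermutation : DistinctResidues → IsSignedPermutation n S
  distinct⇒signedPermutation distinct = injective , values
    where
    ±S-distinct : ∀ b b′ {k k′} (k<n : k < n) (k′<n : k′ < n) → ¬ (b ≡ b′ × k ≡ k′) →
      sgn b (S k) %ℕ N n ≢ sgn b′ (S k′) %ℕ N n
    ±S-distinct b b′ {k} {k′} k<n k′<n ¬same e = distinct (b , fromℕ< k<n) (b′ , fromℕ< k′<n) ¬same′
      (trans (residue b k<n) (trans e (sym (residue b′ k′<n))))
      where
      residue : ∀ b {k} (k<n : k < n) → signed w (b , fromℕ< k<n) %ℕ N n ≡ sgn b (S k) %ℕ N n
      residue b k<n = trans (signed-%ℕ b (fromℕ< k<n)) (cong (λ m → sgn b (S m) %ℕ N n) (toℕ-fromℕ< k<n))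
      ¬same′ : ¬ ((b , fromℕ< k<n) ≡ (b′ , fromℕ< k′<n))
      ¬same′ e = ¬same (cong proj₁ e , trans (sym (toℕ-fromℕ< k<n)) (trans (cong (toℕ ∘ proj₂) e) (toℕ-fromℕ< k′<n)))

    S≢0 : ∀ {k} → k < n → S k ≢ 0ℤ
    S≢0 k<n e = ±S-distinct true false k<n k<n (λ ()) (trans (cong (_%ℕ N n) e) (sym (cong (λ t → (ℤ.- t) %ℕ N n) e)))

    -- −(n+1) and n+1 are congruent modulo N = 2(n+1)
    S≢-[n+1] : ∀ {k} → k < n → S k ≢ ℤ.- + suc n
    S≢-[n+1] k<n e = ±S-distinct true false k<n k<n (λ ())
      (trans (cong (_%ℕ N n) e)
        (trans (%ℕ-shift (N n) {ℤ.- + suc n} {+ suc n} (ℤ.- 1ℤ)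
                 (trans (wrap (+ suc n)) (cong (λ m → + suc n ℤ.+ ℤ.- 1ℤ ℤ.* m) (sym +N≡))))
               (sym (cong (λ t → (ℤ.- t) %ℕ N n) e))))
      where
      wrap : ∀ a → ℤ.- a ≡ a ℤ.+ ℤ.- 1ℤ ℤ.* (a ℤ.+ a)
      wrap = ℤ-solve

    injective : InjectiveBelow n (∣_∣ ∘ S)
    injective k k′ k<n k′<n e with k ≟ k′
    ... | yes k≡k′ = k≡k′
    ... | no k≢k′ with ∣∣≡⇒≡± (S k) (S k′) e
    ...   | inj₁ e₊ = ⊥-elim (±S-distinct true true k<n k′<n (k≢k′ ∘ proj₂) (cong (_%ℕ N n) e₊))
    ...   | inj₂ e₋ = ⊥-elim (±S-distinct true false k<n k′<n (λ ()) (cong (_%ℕ N n) e₋))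
    values : ValuesIn n (∣_∣ ∘ S)
    values k k<n = ∣∣-range (S k) (S∈ k) (S≢0 k<n) (S≢-[n+1] k<n)
      where
      ∣∣-range : ∀ s → InRange s → s ≢ 0ℤ → s ≢ ℤ.- + suc n → 1 ≤ ∣ s ∣ × ∣ s ∣ ≤ n
      ∣∣-range (+ zero)  _             s≢0 _ = ⊥-elim (s≢0 refl)
      ∣∣-range (+ suc x) (_ , +≤+ x<n) _   _ = s≤s z≤n , x<n
      ∣∣-range -[1+ x ]  (-≤- x≤n , _) _   s≢m = s≤s z≤n , ≤∧≢⇒< x≤n (s≢m ∘ cong -[1+_])

  signedPermutation⇒distinct : IsSignedPermutation n S → DistinctResidues
  signedPermutation⇒distinct perm (b , i) (b′ , i′) p≢q e = p≢q (cong₂ _,_ b≡b′ i≡i′)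
    where
    open SignedPermutation {n} {S} perm using (S-bounds; S≢0)
    same : sgn b (S (toℕ i)) ≡ sgn b′ (S (toℕ i′))
    same = %ℕ-injective (inRange (sgn-bounds n b (S-bounds (toℕ<n i)))) (inRange (sgn-bounds n b′ (S-bounds (toℕ<n i′))))
      (trans (sym (signed-%ℕ b i)) (trans e (signed-%ℕ b′ i′)))
    k≡k′ : toℕ i ≡ toℕ i′
    k≡k′ = proj₁ perm (toℕ i) (toℕ i′) (toℕ<n i) (toℕ<n i′)
      (trans (sym (∣sgn∣ b _)) (trans (cong ∣_∣ same) (∣sgn∣ b′ _)))
    i≡i′ : i ≡ i′
    i≡i′ = toℕ-injective k≡k′
    b≡b′ : b ≡ b′
    b≡b′ = sgn-injectiveˡ b b′ (S≢0 (toℕ<n i)) (trans same (cong (λ m → sgn b′ (S m)) (sym k≡k′)))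

-- Type-B inversions

sumℕ : (ℕ → ℕ) → ℕ → ℕ
sumℕ f zero    = 0
sumℕ f (suc k) = sumℕ f k + f k

sumℕ-cong : ∀ {f g} k → (∀ j → j < k → f j ≡ g j) → sumℕ f k ≡ sumℕ g k
sumℕ-cong zero    h = refl
sumℕ-cong (suc k) h = cong₂ _+_ (sumℕ-cong k (λ j p → h j (m<n⇒m<1+n p))) (h k ≤-refl)

sumℕ-bit : ∀ B k → sumℕ (bit ∘ B) k ≡ count B k
sumℕ-bit B zero    = refl
sumℕ-bit B (suc k) = cong (_+ bit (B k)) (sumℕ-bit B k)

sumℕ-1+bit : ∀ B k → sumℕ (λ j → 1 + bit (B j)) k ≡ k + count B k
sumℕ-1+bit B zero    = refl
sumℕ-1+bit B (suc k) = trans (cong (_+ (1 + bit (B k))) (sumℕ-1+bit B k)) (regroup k (count B k) (bit (B k)))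
  where
  regroup : ∀ k c b → k + c + (1 + b) ≡ suc k + (c + b)
  regroup = ℕ-solve

sumℤ-const-sub : ∀ a X k → sumℤ (λ j → a ℤ.- + X j) k ≡ + k ℤ.* a ℤ.- + sumℕ X k
sumℤ-const-sub a X zero = sym (vanish a)
  where
  vanish : ∀ a → 0ℤ ℤ.* a ℤ.- 0ℤ ≡ 0ℤ
  vanish = ℤ-solve
sumℤ-const-sub a X (suc k) = trans (cong (ℤ._+ (a ℤ.- + X k)) (sumℤ-const-sub a X k))
  (trans (regroup (+ k) a (+ sumℕ X k) (+ X k)) (cong (λ t → (1ℤ ℤ.+ + k) ℤ.* a ℤ.- t) (sym (ℤP.pos-+ (sumℕ X k) (X k)))))
  where
  regroup : ∀ K a M x → K ℤ.* a ℤ.- M ℤ.+ (a ℤ.- x) ≡ (1ℤ ℤ.+ K) ℤ.* a ℤ.- (M ℤ.+ x)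
  regroup = ℤ-solve

does-⊖<0 : ∀ m n → does ((m ℤ.⊖ n) ℤ.<? 0ℤ) ≡ does (m <? n)
does-⊖<0 m n = does-cong to from ((m ℤ.⊖ n) ℤ.<? 0ℤ) (m <? n)
  where
  to : m ℤ.⊖ n ℤ.< 0ℤ → m < n
  to lt with m <? n
  ... | yes m<n = m<n
  ... | no m≮n = ⊥-elim (ℤP.+≮0 (subst (ℤ._< 0ℤ) (ℤP.⊖-≥ (≮⇒≥ m≮n)) lt))
  from : m < n → m ℤ.⊖ n ℤ.< 0ℤ
  from m<n = subst (ℤ._< 0ℤ) (sym (ℤP.⊖-< m<n)) (negative (n ∸ m) (m<n⇒0<n∸m m<n))
    where
    negative : ∀ x → 0 < x → ℤ.- + x ℤ.< 0ℤ
    negative (suc x) _ = -<+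

does-sub<0 : ∀ a b → does ((a ℤ.- b) ℤ.<? 0ℤ) ≡ does (a ℤ.<? b)
does-sub<0 a b = does-cong to from ((a ℤ.- b) ℤ.<? 0ℤ) (a ℤ.<? b)
  where
  to : a ℤ.- b ℤ.< 0ℤ → a ℤ.< b
  to lt = subst₂ ℤ._<_ (sub-add a b) (ℤP.+-identityˡ b) (ℤP.+-monoˡ-< b lt)
    where
    sub-add : ∀ a b → a ℤ.- b ℤ.+ b ≡ a
    sub-add = ℤ-solve
  from : a ℤ.< b → a ℤ.- b ℤ.< 0ℤ
  from lt = subst (a ℤ.- b ℤ.<_) (ℤP.+-inverseʳ b) (ℤP.+-monoˡ-< (ℤ.- b) lt)

-- For s > 0 the pair (j, k) contributes one type-B inversion iff |s| < |t|,
-- for s < 0 it contributes one plus one more iff |t| < |s|.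
inversion-pair-pos : ∀ a t →
  bit (does (+ suc a ℤ.<? t)) + bit (does ((+ suc a ℤ.+ t) ℤ.<? 0ℤ)) ≡ bit (does (suc a <? ∣ t ∣))
inversion-pair-pos a (+ b) = trans
  (cong₂ _+_ (cong bit (does-cong ℤP.drop‿+<+ +<+ (+ suc a ℤ.<? + b) (suc a <? b)))
             (cong bit (dec-false (+ (suc a + b) ℤ.<? 0ℤ) ℤP.+≮0)))
  (+-identityʳ _)
inversion-pair-pos a -[1+ b ] = cong₂ _+_ (cong bit (dec-false (+ suc a ℤ.<? -[1+ b ]) (λ ())))
                                          (cong bit (does-⊖<0 (suc a) (suc b)))

inversion-pair-neg : ∀ a t → suc a ≢ ∣ t ∣ →
  bit (does (-[1+ a ] ℤ.<? t)) + bit (does ((-[1+ a ] ℤ.+ t) ℤ.<? 0ℤ)) ≡ 1 + bit (not (does (suc a <? ∣ t ∣)))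
inversion-pair-neg a (+ b) a≢b = cong₂ _+_ (cong bit (dec-true (-[1+ a ] ℤ.<? + b) -<+))
  (cong bit (trans (does-⊖<0 b (suc a))
    (does-cong (λ b<a a<b → <-asym b<a a<b) (λ a≮b → ≤∧≢⇒< (≮⇒≥ a≮b) (a≢b ∘ sym)) (b <? suc a) (¬? (suc a <? b)))))
inversion-pair-neg a -[1+ b ] a≢b = trans
  (cong₂ _+_ (cong bit (does-cong ℤP.drop‿-<- -<- (-[1+ a ] ℤ.<? -[1+ b ]) (b <? a)))
             (cong bit (dec-true (-[1+ suc (a + b) ] ℤ.<? 0ℤ) -<+)))
  (trans (+-comm _ 1) (cong (λ x → 1 + bit x)
    (does-cong (λ b<a a<b → <-asym b<a (≤-pred a<b)) (λ a≮b → ≤∧≢⇒< (≮⇒≥ (a≮b ∘ s≤s)) (a≢b ∘ cong suc ∘ sym))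
               (b <? a) (¬? (suc a <? suc b)))))

ψ-max∸ : ∀ k c c′ → c + c′ ≡ k → k + c′ + 1 ≡ ψ-max k ∸ c
ψ-max∸ .(c + c′) c c′ refl = sym (trans (cong (_∸ c) (expand c c′)) (m+n∸m≡n c _))
  where
  expand : ∀ c c′ → (c + c′) + suc ((c + c′) + 0) ≡ c + (c + c′ + c′ + 1)
  expand = ℕ-solve

-- ψ counts type-B inversions: pairs j < k with σ_j > σ_k or σ_j + σ_k < 0, and j = k with σ_k < 0.
inversions≡ψ-entry : ∀ (s : ℤ) (T : ℕ → ℤ) k → s ≢ 0ℤ → (∀ j → j < k → ∣ s ∣ ≢ ∣ T j ∣) →
  sumℕ (λ j → bit (does (s ℤ.<? T j)) + bit (does ((s ℤ.+ T j) ℤ.<? 0ℤ))) k + bit (does ((s ℤ.+ s) ℤ.<? 0ℤ))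
  ≡ ψ-entry k s (count (λ j → does (∣ s ∣ <? ∣ T j ∣)) k)
inversions≡ψ-entry (+ zero)  T k s≢0 _ = ⊥-elim (s≢0 refl)
inversions≡ψ-entry (+ suc a) T k _   _ = trans
  (cong₂ _+_ (trans (sumℕ-cong k (λ j _ → inversion-pair-pos a (T j))) (sumℕ-bit _ k))
             (cong bit (dec-false (+ (suc a + suc a) ℤ.<? 0ℤ) ℤP.+≮0)))
  (+-identityʳ _)
inversions≡ψ-entry -[1+ a ]  T k _   distinct = trans
  (cong₂ _+_ (trans (sumℕ-cong k (λ j j<k → inversion-pair-neg a (T j) (distinct j j<k))) (sumℕ-1+bit _ k))
             (cong bit (dec-true (-[1+ suc (a + a) ] ℤ.<? 0ℤ) -<+)))
  (ψ-max∸ k (count B k) (count (not ∘ B) k) (count-+-count-not B k))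
  where
  B = λ j → does (suc a <? ∣ T j ∣)

module Inversions {n : ℕ} (w : Vec ℤ n) (perm : IsSignedPermutation n (Window.S w)) where
  open Window w
  open SignedResidue n
  open SignedPermutation {n} {S} perm

  I : ℕ → ℕ → ℤ
  I k j = (W k ℤ.- W j) /ℕ N n ℤ.+ (W k ℤ.+ W j) /ℕ N n

  Ii≡sumℤ : ∀ (i : Fin n) → Ii w i ≡ sumℤ (I (toℕ i)) (suc (toℕ i))
  Ii≡sumℤ i = trans
    (∑-filter≡sumℤ (λ j → toℕ j ≤? toℕ i) (Iij w i) n id (λ j → if does (j ≤? toℕ i) then I (toℕ i) j else 0ℤ)
      (λ j → cong (if does (toℕ j ≤? toℕ i) then_else 0ℤ)
        (cong₂ (λ a b → (a ℤ.- b) /ℕ N n ℤ.+ (a ℤ.+ b) /ℕ N n) (sym (at-lookup w i)) (sym (at-lookup w j)))))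
    (sumℤ-restrict (I (toℕ i)) (toℕ i) n (toℕ<n i))

  sum-in-window : ∀ {s t} → ℤ.- + n ℤ.≤ s × s ℤ.≤ + n → ℤ.- + n ℤ.≤ t × t ℤ.≤ + n →
    ℤ.- + N n ℤ.≤ s ℤ.+ t × s ℤ.+ t ℤ.< + N n
  sum-in-window (s≥ , s≤) (t≥ , t≤) =
    ℤP.≤-trans (ℤP.neg-mono-≤ (ℤP.<⇒≤ 2n<N))
               (ℤP.≤-trans (ℤP.≤-reflexive (ℤP.neg-distrib-+ (+ n) (+ n))) (ℤP.+-mono-≤ s≥ t≥)) ,
    ℤP.≤-<-trans (ℤP.+-mono-≤ s≤ t≤) 2n<N
    where
    2n<N : + n ℤ.+ + n ℤ.< + N n
    2n<N = subst₂ ℤ._<_ (ℤP.pos-+ n n) (sym +N≡) (ℤP.+-mono-< (+<+ (n<1+n n)) (+<+ (n<1+n n)))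

  I-entry : ∀ {k j} → k < n → j < n →
    I k j ≡ (C k ℤ.+ C k) ℤ.- + (bit (does (S k ℤ.<? S j)) + bit (does ((S k ℤ.+ S j) ℤ.<? 0ℤ)))
  I-entry {k} {j} k<n j<n = begin
    I k j
      ≡⟨ cong₂ ℤ._+_ (floor-/ℕ (N n) (C k ℤ.- C j) (S k ℤ.- S j) diff (proj₁ diff∈) (proj₂ diff∈))
                     (floor-/ℕ (N n) (C k ℤ.+ C j) (S k ℤ.+ S j) sum (proj₁ sum∈) (proj₂ sum∈)) ⟩
    (C k ℤ.- C j ℤ.- + x) ℤ.+ (C k ℤ.+ C j ℤ.- + y)
      ≡⟨ cancel (C k) (C j) (+ x) (+ y) ⟩
    (C k ℤ.+ C k) ℤ.- (+ x ℤ.+ + y)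
      ≡⟨ cong (λ a → (C k ℤ.+ C k) ℤ.- (+ bit a ℤ.+ + y)) (does-sub<0 (S k) (S j)) ⟩
    (C k ℤ.+ C k) ℤ.- (+ x′ ℤ.+ + y)
      ≡⟨ cong (λ t → (C k ℤ.+ C k) ℤ.- t) (sym (ℤP.pos-+ x′ y)) ⟩
    (C k ℤ.+ C k) ℤ.- + (x′ + y) ∎
    where
    open ≡-Reasoning
    x = bit (does ((S k ℤ.- S j) ℤ.<? 0ℤ))
    x′ = bit (does (S k ℤ.<? S j))
    y = bit (does ((S k ℤ.+ S j) ℤ.<? 0ℤ))
    cancel : ∀ a b x y → (a ℤ.- b ℤ.- x) ℤ.+ (a ℤ.+ b ℤ.- y) ≡ (a ℤ.+ a) ℤ.- (x ℤ.+ y)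
    cancel = ℤ-solve
    diff : W k ℤ.- W j ≡ (C k ℤ.- C j) ℤ.* + N n ℤ.+ (S k ℤ.- S j)
    diff = trans (cong₂ ℤ._-_ (split k) (split j)) (regroup (C k) (C j) (S k) (S j) (+ N n))
      where
      regroup : ∀ a b s t m → a ℤ.* m ℤ.+ s ℤ.- (b ℤ.* m ℤ.+ t) ≡ (a ℤ.- b) ℤ.* m ℤ.+ (s ℤ.- t)
      regroup = ℤ-solve
    sum : W k ℤ.+ W j ≡ (C k ℤ.+ C j) ℤ.* + N n ℤ.+ (S k ℤ.+ S j)
    sum = trans (cong₂ ℤ._+_ (split k) (split j)) (regroup (C k) (C j) (S k) (S j) (+ N n))
      where
      regroup : ∀ a b s t m → a ℤ.* m ℤ.+ s ℤ.+ (b ℤ.* m ℤ.+ t) ≡ (a ℤ.+ b) ℤ.* m ℤ.+ (s ℤ.+ t)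
      regroup = ℤ-solve
    diff∈ = sum-in-window (S-bounds k<n) (sgn-bounds n false (S-bounds j<n))
    sum∈ = sum-in-window (S-bounds k<n) (S-bounds j<n)

  I-diagonal : ∀ {k} → k < n → I k k ≡ (C k ℤ.+ C k) ℤ.- + bit (does ((S k ℤ.+ S k) ℤ.<? 0ℤ))
  I-diagonal {k} k<n = begin
    (W k ℤ.- W k) /ℕ N n ℤ.+ (W k ℤ.+ W k) /ℕ N n ≡⟨ cong (λ t → t /ℕ N n ℤ.+ (W k ℤ.+ W k) /ℕ N n) (ℤP.+-inverseʳ (W k)) ⟩
    0ℤ ℤ.+ (W k ℤ.+ W k) /ℕ N n                   ≡⟨ ℤP.+-identityˡ _ ⟩
    (W k ℤ.+ W k) /ℕ N n                          ≡⟨ floor-/ℕ (N n) (C k ℤ.+ C k) (S k ℤ.+ S k) double (proj₁ sum∈) (proj₂ sum∈) ⟩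
    (C k ℤ.+ C k) ℤ.- + bit (does ((S k ℤ.+ S k) ℤ.<? 0ℤ)) ∎
    where
    open ≡-Reasoning
    double : W k ℤ.+ W k ≡ (C k ℤ.+ C k) ℤ.* + N n ℤ.+ (S k ℤ.+ S k)
    double = trans (cong₂ ℤ._+_ (split k) (split k)) (regroup (C k) (S k) (+ N n))
      where
      regroup : ∀ a s m → a ℤ.* m ℤ.+ s ℤ.+ (a ℤ.* m ℤ.+ s) ≡ (a ℤ.+ a) ℤ.* m ℤ.+ (s ℤ.+ s)
      regroup = ℤ-solve
    sum∈ = sum-in-window (S-bounds k<n) (S-bounds k<n)

  sum-I≡Λ : ∀ {k} → k < n → sumℤ (I k) (suc k) ≡ Λ C S k
  sum-I≡Λ {k} k<n = begin
    sumℤ (I k) k ℤ.+ I k k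
      ≡⟨ cong₂ ℤ._+_ (sumℤ-cong k (λ j j<k → I-entry k<n (<-trans j<k k<n))) (I-diagonal k<n) ⟩
    sumℤ (λ j → 2C ℤ.- + X j) k ℤ.+ (2C ℤ.- + z)
      ≡⟨ cong (ℤ._+ (2C ℤ.- + z)) (sumℤ-const-sub 2C X k) ⟩
    (+ k ℤ.* 2C ℤ.- + sumℕ X k) ℤ.+ (2C ℤ.- + z)
      ≡⟨ collect (+ k) (C k) (+ sumℕ X k) (+ z) ⟩
    ((1ℤ ℤ.+ + k) ℤ.+ (1ℤ ℤ.+ + k)) ℤ.* C k ℤ.- (+ sumℕ X k ℤ.+ + z)
      ≡⟨ cong₂ (λ a b → a ℤ.* C k ℤ.- b) (sym (+2[1+k] k)) (sym (ℤP.pos-+ (sumℕ X k) z)) ⟩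
    + (2 * suc k) ℤ.* C k ℤ.- + (sumℕ X k + z)
      ≡⟨ cong (λ t → + (2 * suc k) ℤ.* C k ℤ.- + t) (inversions≡ψ-entry (S k) S k (S≢0 k<n) earlier-distinct) ⟩
    Λ C S k ∎
    where
    open ≡-Reasoning
    2C = C k ℤ.+ C k
    X = λ j → bit (does (S k ℤ.<? S j)) + bit (does ((S k ℤ.+ S j) ℤ.<? 0ℤ))
    z = bit (does ((S k ℤ.+ S k) ℤ.<? 0ℤ))
    collect : ∀ K c M z → (K ℤ.* (c ℤ.+ c) ℤ.- M) ℤ.+ ((c ℤ.+ c) ℤ.- z) ≡ ((1ℤ ℤ.+ K) ℤ.+ (1ℤ ℤ.+ K)) ℤ.* c ℤ.- (M ℤ.+ z)
    collect = ℤ-solve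
    +2[1+k] : ∀ k → + (2 * suc k) ≡ (1ℤ ℤ.+ + k) ℤ.+ (1ℤ ℤ.+ + k)
    +2[1+k] k = trans (cong +_ (double k)) (ℤP.pos-+ (suc k) (suc k))
      where
      double : ∀ k → 2 * suc k ≡ suc k + suc k
      double = ℕ-solve
    earlier-distinct : ∀ j → j < k → ∣ S k ∣ ≢ ∣ S j ∣
    earlier-distinct j j<k e = <⇒≢ j<k (proj₁ perm j k (<-trans j<k k<n) k<n (sym e))

  Φ≡Ii : ∀ (i : Fin n) → lookup (Φ w) i ≡ Ii w i
  Φ≡Ii i = trans (Φ-entry i) (sym (trans (Ii≡sumℤ i) (sum-I≡Λ (toℕ<n i))))

LectureHall-cong : ∀ {n L L′} → (∀ {k} → k < n → L k ≡ L′ k) → LectureHall n L → LectureHall n L′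
LectureHall-cong {n} {L} {L′} L≡L′ (first , step) =
  (λ 0<n → subst (0ℤ ℤ.≤_) (L≡L′ 0<n) (first 0<n)) ,
  (λ k k+1<n → subst₂ ℤ._≤_ (cong (ℤ._* + suc (suc k)) (L≡L′ (<-trans (n<1+n k) k+1<n)))
                            (cong (ℤ._* + suc k) (L≡L′ k+1<n)) (step k k+1<n))

ratio-≤⇔ : ∀ {x y d d′} → mkℚᵘ x d ≤q mkℚᵘ y d′ ⇔ x ℤ.* + suc d′ ℤ.≤ y ℤ.* + suc d
ratio-≤⇔ = mk⇔ (λ { (*≤* le) → le }) *≤*

isLectureHall⇔ : ∀ {n} (v : Vec ℤ n) → IsLectureHall n v ⇔ LectureHall n (at v)
isLectureHall⇔ {n} v = mk⇔ (Prod.map (Equivalence.to first) (Equivalence.to step))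
                           (Prod.map (Equivalence.from first) (Equivalence.from step))
  where
  nonneg⇔ : ∀ (i : Fin n) → 0ℚᵘ ≤q ratio v i ⇔ 0ℤ ℤ.≤ lookup v i
  nonneg⇔ i = ⇔.trans ratio-≤⇔ (≤-cong-⇔ (ℤP.*-zeroˡ (+ suc (toℕ i))) (ℤP.*-identityʳ (lookup v i)))
  first : (∀ (i : Fin n) → toℕ i ≡ 0 → 0ℚᵘ ≤q ratio v i) ⇔ (0 < n → 0ℤ ℤ.≤ at v 0)
  first = ⇔.trans (mk⇔ (λ h i e → Equivalence.to (nonneg⇔ i) (h i e)) (λ h i e → Equivalence.from (nonneg⇔ i) (h i e)))
                  (first-fin⇔ v (0ℤ ℤ.≤_))
  R : ℕ → ℤ → ℤ → Set
  R k x y = x ℤ.* + suc (suc k) ℤ.≤ y ℤ.* + suc k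
  adjacent⇔ : ∀ (i j : Fin n) → toℕ j ≡ suc (toℕ i) → ratio v i ≤q ratio v j ⇔ R (toℕ i) (lookup v i) (lookup v j)
  adjacent⇔ i j j≡ = ⇔.trans ratio-≤⇔ (≤-cong-⇔ (cong (λ m → lookup v i ℤ.* + suc m) j≡) refl)
  step : (∀ (i j : Fin n) → toℕ j ≡ suc (toℕ i) → ratio v i ≤q ratio v j) ⇔
         (∀ k → suc k < n → R k (at v k) (at v (suc k)))
  step = ⇔.trans (mk⇔ (λ h i j e → Equivalence.to (adjacent⇔ i j e) (h i j e))
                      (λ h i j e → Equivalence.from (adjacent⇔ i j e) (h i j e)))
                 (adjacent-fin⇔ v R)

isWindow⇔ : ∀ {n} (w : Vec ℤ n) → IsWindow n w ⇔ (PositiveIncreasing n (at w) × Window.DistinctResidues w)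
isWindow⇔ w = mk⇔ (λ (pos , inc , distinct) → (Equivalence.to first pos , Equivalence.to step inc) , distinct)
                  (λ ((pos , inc) , distinct) → Equivalence.from first pos , Equivalence.from step inc , distinct)
  where
  first = first-fin⇔ w (0ℤ ℤ.<_)
  step = adjacent-fin⇔ w (λ _ x y → x ℤ.< y)

window⇒signedPermutation : ∀ {n} (w : Vec ℤ n) → IsWindow n w → IsSignedPermutation n (Window.S w)
window⇒signedPermutation w = Window.distinct⇒signedPermutation w ∘ proj₂ ∘ Equivalence.to (isWindow⇔ w)

window⇒lectureHall : ∀ {n} (w : Vec ℤ n) → IsWindow n w → IsLectureHall n (Φ w)
window⇒lectureHall w isWindow = Equivalence.from (isLectureHall⇔ (Φ w))
  (LectureHall-cong (sym ∘ at-Φ) (Equivalence.to positiveIncreasing⇔lectureHall order))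
  where
  open Window w
  order = proj₁ (Equivalence.to (isWindow⇔ w) isWindow)
  open WindowOrder W C S (λ {k} _ → split k) (window⇒signedPermutation w isWindow)

Λ-entry-injective : ∀ k {c c′ e e′} → e ≤ ψ-max k → e′ ≤ ψ-max k →
  + (2 * suc k) ℤ.* c ℤ.- + e ≡ + (2 * suc k) ℤ.* c′ ℤ.- + e′ → c ≡ c′ × e ≡ e′
Λ-entry-injective k {c} {c′} {e} {e′} e≤ e′≤ eq = Prod.map₂ (ℤP.+-injective ∘ ℤP.neg-injective)
  (lex-unique (2 * suc k) {c} {c′} {ℤ.- + e} {ℤ.- + e′}
    (subst (Small (2 * suc k)) (swap-neg (+ e) (+ e′)) (small-∸ (s≤s e≤) (s≤s e′≤)))
    (trans (sym (reorder c (+ e))) (trans eq (reorder c′ (+ e′)))))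
  where
  swap-neg : ∀ a b → a ℤ.- b ≡ ℤ.- b ℤ.- ℤ.- a
  swap-neg = ℤ-solve
  reorder : ∀ c e → + (2 * suc k) ℤ.* c ℤ.- e ≡ c ℤ.* + (2 * suc k) ℤ.- e
  reorder c e = cong (ℤ._- e) (ℤP.*-comm (+ (2 * suc k)) c)

ψ-entry-injective : ∀ k s s′ {c c′} → c ≤ k → c′ ≤ k → ψ-entry k s c ≡ ψ-entry k s′ c′ →
  does (0ℤ ℤ.<? s) ≡ does (0ℤ ℤ.<? s′) × c ≡ c′
ψ-entry-injective k s s′ {c} {c′} c≤k c′≤k eq with does (0ℤ ℤ.<? s) | does (0ℤ ℤ.<? s′)
... | true  | true  = refl , eq
... | false | false = refl , ∸-cancelˡ (≤-trans c≤k k≤ψ-max) (≤-trans c′≤k k≤ψ-max) eq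
  where
  k≤ψ-max = m≤m+n k _
  ∸-cancelˡ : ∀ {m a b} → a ≤ m → b ≤ m → m ∸ a ≡ m ∸ b → a ≡ b
  ∸-cancelˡ {m} {a} {b} a≤m b≤m e = trans (sym (m∸[m∸n]≡n a≤m)) (trans (cong (m ∸_) e) (m∸[m∸n]≡n b≤m))
... | true  | false = ⊥-elim (<⇒≱ (subst (k <_) (sym eq) (k<ψ-max∸ k c′ c′≤k)) c≤k)
... | false | true  = ⊥-elim (<⇒≱ (subst (k <_) eq (k<ψ-max∸ k c c≤k)) c′≤k)

same-sign-abs⇒≡ : ∀ s t → s ≢ 0ℤ → t ≢ 0ℤ → does (0ℤ ℤ.<? s) ≡ does (0ℤ ℤ.<? t) → ∣ s ∣ ≡ ∣ t ∣ → s ≡ t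
same-sign-abs⇒≡ (+ zero)  t         s≢0 _ _ _ = ⊥-elim (s≢0 refl)
same-sign-abs⇒≡ s         (+ zero)  _ t≢0 _ _ = ⊥-elim (t≢0 refl)
same-sign-abs⇒≡ (+ suc a) (+ suc b) _ _ _ e = cong +_ e
same-sign-abs⇒≡ -[1+ a ]  -[1+ b ]  _ _ _ e = cong -[1+_] (suc-injective e)
same-sign-abs⇒≡ (+ suc a) -[1+ b ]  _ _ () _
same-sign-abs⇒≡ -[1+ a ]  (+ suc b) _ _ () _

-- Λ determines C and ψ; ψ determines the signs of S and the code of ∣S∣, which determines ∣S∣.
window-injective : ∀ {n} (w w′ : Vec ℤ n) → IsWindow n w → IsWindow n w′ → Φ w ≡ Φ w′ → w ≡ w′
window-injective {n} w w′ isWindow isWindow′ Φ≡ = at-injective w w′ W≡W′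
  where
  module X = Window w
  module X′ = Window w′
  perm = window⇒signedPermutation w isWindow
  perm′ = window⇒signedPermutation w′ isWindow′
  module P = SignedPermutation {n} {X.S} perm
  module P′ = SignedPermutation {n} {X′.S} perm′
  C≡∧ψ≡ : ∀ {k} → k < n → X.C k ≡ X′.C k × ψ X.S k ≡ ψ X′.S k
  C≡∧ψ≡ k<n = Λ-entry-injective _ (ψ≤ψ-max X.S _) (ψ≤ψ-max X′.S _)
    (trans (sym (X.at-Φ k<n)) (trans (cong (λ v → at v _) Φ≡) (X′.at-Φ k<n)))
  sign≡∧code≡ : ∀ {k} → k < n →
    does (0ℤ ℤ.<? X.S k) ≡ does (0ℤ ℤ.<? X′.S k) × code (∣_∣ ∘ X.S) k ≡ code (∣_∣ ∘ X′.S) k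
  sign≡∧code≡ {k} k<n = ψ-entry-injective k (X.S k) (X′.S k) (code≤ (∣_∣ ∘ X.S) k) (code≤ (∣_∣ ∘ X′.S) k) (proj₂ (C≡∧ψ≡ k<n))
  S≡S′ : ∀ {k} → k < n → X.S k ≡ X′.S k
  S≡S′ {k} k<n = same-sign-abs⇒≡ (X.S k) (X′.S k) (P.S≢0 k<n) (P′.S≢0 k<n) (proj₁ (sign≡∧code≡ k<n))
    (code-injective (∣_∣ ∘ X.S) (∣_∣ ∘ X′.S) n perm perm′ (λ i i<n → proj₂ (sign≡∧code≡ i<n)) k k<n)
  W≡W′ : ∀ k → k < n → X.W k ≡ X′.W k
  W≡W′ k k<n = trans (X.split k)
    (trans (cong₂ (λ c s → c ℤ.* + N n ℤ.+ s) (proj₁ (C≡∧ψ≡ k<n)) (S≡S′ k<n)) (sym (X′.split k)))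

ψ-cong : ∀ {S S′} k → (∀ j → j ≤ k → S j ≡ S′ j) → ψ S k ≡ ψ S′ k
ψ-cong k S≡ = cong₂ (ψ-entry k) (S≡ k ≤-refl)
  (count-cong k (λ j j<k → cong₂ (λ x y → does (∣ x ∣ <? ∣ y ∣)) (S≡ k ≤-refl) (S≡ j (<⇒≤ j<k))))

signedPermutation-cong : ∀ {n S S′} → (∀ {k} → k < n → ∣ S k ∣ ≡ ∣ S′ k ∣) →
  IsSignedPermutation n S → IsSignedPermutation n S′
signedPermutation-cong {n} S≡ (inj , values) =
  (λ i j i<n j<n e → inj i j i<n j<n (trans (S≡ i<n) (trans e (sym (S≡ j<n))))) ,
  (λ j j<n → subst (λ m → 1 ≤ m × m ≤ n) (S≡ j<n) (values j j<n))

ψ-entry-sgn : ∀ k b {x} c → 1 ≤ x → ψ-entry k (sgn b (+ x)) c ≡ (if b then c else ψ-max k ∸ c)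
ψ-entry-sgn k true  {suc x} c _ = refl
ψ-entry-sgn k false {suc x} c _ = refl

-- The preimage of a lecture hall partition v: write v_k = 2(k+1) c_k − e_k with
-- 0 ≤ e_k ≤ 2k+1, read the sign of σ_k off e_k ≤ k, and decode ∣σ∣ from the code d.
module Preimage {n : ℕ} (v : Vec ℤ n) where
  open SignedResidue n

  V : ℕ → ℤ
  V = at v

  e : ℕ → ℕ
  e k = (ℤ.- V k) %ℕ (2 * suc k)

  c : ℕ → ℤ
  c k = ℤ.- ((ℤ.- V k) /ℕ (2 * suc k))

  V≡Λ-entry : ∀ k → V k ≡ + (2 * suc k) ℤ.* c k ℤ.- + e k
  V≡Λ-entry k = trans (sym (ℤP.neg-involutive (V k)))
    (trans (cong ℤ.-_ (a≡a%ℕn+[a/ℕn]*n (ℤ.- V k) (2 * suc k))) (negate (+ e k) ((ℤ.- V k) /ℕ (2 * suc k)) (+ (2 * suc k))))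
    where
    negate : ∀ e q d → ℤ.- (e ℤ.+ q ℤ.* d) ≡ d ℤ.* (ℤ.- q) ℤ.- e
    negate = ℤ-solve

  e≤ψ-max : ∀ k → e k ≤ ψ-max k
  e≤ψ-max k = ≤-pred (n%ℕd<d (ℤ.- V k) (2 * suc k))

  positive : ℕ → Bool
  positive k = does (e k ≤? k)

  d : ℕ → ℕ
  d k = if positive k then e k else ψ-max k ∸ e k

  d≤ : ∀ k → d k ≤ k
  d≤ k with does-view (e k ≤? k)
  ... | inj₁ (e≤k , eq) rewrite eq = e≤k
  ... | inj₂ (e≰k , eq) rewrite eq = ≤-trans (∸-monoʳ-≤ (ψ-max k) (≰⇒> e≰k)) (≤-reflexive (ψ-max∸suc k))
    where
    ψ-max∸suc : ∀ k → ψ-max k ∸ suc k ≡ k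
    ψ-max∸suc k = trans (cong (λ t → (k + suc t) ∸ suc k) (+-identityʳ k)) (m+n∸n≡m k (suc k))

  open Decode d d≤

  a : ℕ → ℕ
  a = decode d n

  σ : ℕ → ℤ
  σ k = sgn (positive k) (+ a k)

  σ-perm : IsSignedPermutation n σ
  σ-perm = signedPermutation-cong {S = +_ ∘ a} {S′ = σ} (λ {k} _ → sym (∣sgn∣ (positive k) (+ a k))) (decode-permutation n)

  ψσ≡e : ∀ {k} → k < n → ψ σ k ≡ e k
  ψσ≡e {k} k<n = begin
    ψ-entry k (σ k) (code (∣_∣ ∘ σ) k)           ≡⟨ cong (ψ-entry k (σ k)) (trans code-∣σ∣ (code-decode n k k<n)) ⟩
    ψ-entry k (σ k) (d k)                       ≡⟨ ψ-entry-sgn k (positive k) (d k) (proj₁ (decode-values n k k<n)) ⟩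
    (if positive k then d k else ψ-max k ∸ d k) ≡⟨ undo (positive k) ⟩
    e k ∎
    where
    open ≡-Reasoning
    code-∣σ∣ : code (∣_∣ ∘ σ) k ≡ code a k
    code-∣σ∣ = count-cong k (λ j _ → cong₂ (λ x y → does (x <? y)) (∣sgn∣ (positive k) (+ a k)) (∣sgn∣ (positive j) (+ a j)))
    undo : ∀ b → (if b then (if b then e k else ψ-max k ∸ e k) else ψ-max k ∸ (if b then e k else ψ-max k ∸ e k)) ≡ e k
    undo true  = refl
    undo false = m∸[m∸n]≡n (e≤ψ-max k)

  Λ≡V : ∀ {k} → k < n → Λ c σ k ≡ V k
  Λ≡V {k} k<n = trans (cong (λ t → + (2 * suc k) ℤ.* c k ℤ.- + t) (ψσ≡e k<n)) (sym (V≡Λ-entry k))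

  w : Vec ℤ n
  w = tabulate (λ i → c (toℕ i) ℤ.* + N n ℤ.+ σ (toℕ i))

  module X = Window w

  split : ∀ {k} → k < n → X.W k ≡ c k ℤ.* + N n ℤ.+ σ k
  split {k} k<n = at-tabulate (λ k → c k ℤ.* + N n ℤ.+ σ k) k k<n

  S≡σ∧C≡c : ∀ {k} → k < n → X.S k ≡ σ k × X.C k ≡ c k
  S≡σ∧C≡c k<n = sigma-coef-unique _ _ (split k<n) (inRange (SignedPermutation.S-bounds {n} {σ} σ-perm k<n))

  Φ≡v : Φ w ≡ v
  Φ≡v = at-injective (Φ w) v λ k k<n → begin
    at (Φ w) k    ≡⟨ X.at-Φ k<n ⟩
    Λ X.C X.S k   ≡⟨ cong₂ (λ c′ ψ′ → + (2 * suc k) ℤ.* c′ ℤ.- + ψ′) (proj₂ (S≡σ∧C≡c k<n))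
                           (ψ-cong k (λ j j≤k → proj₁ (S≡σ∧C≡c (≤-<-trans j≤k k<n)))) ⟩
    Λ c σ k       ≡⟨ Λ≡V k<n ⟩
    V k ∎
    where open ≡-Reasoning

  window : IsLectureHall n v → IsWindow n w
  window isLH = Equivalence.from (isWindow⇔ w) (order , distinct)
    where
    open WindowOrder X.W c σ split σ-perm
    order = Equivalence.from positiveIncreasing⇔lectureHall
              (LectureHall-cong (sym ∘ Λ≡V) (Equivalence.to (isLectureHall⇔ v) isLH))
    distinct = X.signedPermutation⇒distinct
                 (signedPermutation-cong {S = σ} {S′ = X.S} (λ k<n → cong ∣_∣ (sym (proj₁ (S≡σ∧C≡c k<n)))) σ-perm)

Φ≡Ii : ∀ {n} (w : Vec ℤ n) → IsWindow n w → ∀ (i : Fin n) → lookup (Φ w) i ≡ Ii w i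
Φ≡Ii w isWindow = Inversions.Φ≡Ii w (window⇒signedPermutation w isWindow)

mainTheorem1 : (n : ℕ) → 1 ≤ n →
    ((w : Vec ℤ n) → IsWindow n w → IsLectureHall n (Φ w)) ×
    ((w w′ : Vec ℤ n) → IsWindow n w → IsWindow n w′ → Φ w ≡ Φ w′ → w ≡ w′) ×
    ((v : Vec ℤ n) → IsLectureHall n v → ∃ λ w → IsWindow n w × Φ w ≡ v) ×
    ((w : Vec ℤ n) → IsWindow n w →
      ((i : Fin n) → lookup (Φ w) i ≡ Ii w i) × (sumV (Φ w) ≡ invC w))
mainTheorem1 n _ =
  window⇒lectureHall ,
  window-injective ,
  (λ v isLectureHall → Preimage.w v , Preimage.window v isLectureHall , Preimage.Φ≡v v) ,
  (λ w isWindow → Φ≡Ii w isWindow , ∑-cong (allFin n) (Φ≡Ii w isWindow))
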